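{- (1) Let $A,B$ be labeled terms, $S$ a finite sequence of variables, $x$ a variable and $k\ge0$, such that $x\notin S\cap\mathrm{FV}(A)$, $x\notin\mathrm{FV}(B)$ and $B$ is away from $S$. Then $(A[x:=B])^{*}_{S,k}$ exists iff there exist $n,m\ge0$ with $k=n+m$ such that $A^{*}_{S,n}$ and $B^{*}_{S,m}$ exist and, if $m>0$, $A^{*}_{S,n}$ has the form $\lambda^{a_1}x_1.\cdots\lambda^{a_n}x_n.x$. Moreover, in that case $(A[x:=B])^{*}_{S,k}=A^{*}_{S,n}[x:=B^{*}_{S,m}]$. (2) Let $A,B$ be labeled terms, $S_1,S_2$ finite sequences of variables with (the underlying set of) $S_1\supseteq S_2$, and $k_1\le k_2$ non-negative integers, such that $A\Rightarrow_{S_1,k_1}B$. Then $A^{*}_{S_2,k_2}$ exists iff $B^{*}_{S_2,k_2}$ exists, and if they exist they are equal. (3) Let $A_1,\dots,A_n$ be labeled terms, $S$ a finite sequence of variables and $k\ge 0$, with $A_i\Rightarrow_{S,k}A_{i+1}$ for all $1\le i<n$. Then $A_1^{*}_{S,k}$ exists iff $A_n^{*}_{S,k}$ exists, and if they exist they are equal.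
   Context: Labeled terms: $A ::= x \mid \lambda^a x.A \mid A\,@^a A$ with labels from a countably infinite set containing a distinguished never-bound label $\star$; in $A\,@^a B$ the label $a$ binds the occurrences of $a$ in $A$. Terms are up to renaming of bound variables/labels. $A[x:=B]$ is substitution capturing neither variables nor labels; $A[a:=\star]$ replaces free occurrences of $a$ by $\star$; $\mathrm{FV}$ is the set of free variables. A term is away from a sequence $S$ if none of its free variables occur in $S$; $x\cdot S$ prepends $x$. Labeled superstep $\Rightarrow_{S,k}$: $x\Rightarrow_{S,0}x$; $A\Rightarrow_{x\cdot S,0}A'$ gives $\lambda^a x.A\Rightarrow_{S,0}\lambda^a x.A'$; $A\Rightarrow_{S,k}A'$ gives $\lambda^a x.A\Rightarrow_{S,k+1}\lambda^a x.A'$; $A\Rightarrow_{S,0}A'$ and $B\Rightarrow_{S,0}B'$ give $A\,@^aB\Rightarrow_{S,0}A'\,@^aB'$; if $A\Rightarrow_{S,n+1}\lambda^a x.A'$, $B\Rightarrow_{S,m}B'$, $(\lambda^a x.A')\,@^a B'$ is away from $S$, and ($m>0\Rightarrow A'=\lambda^{a_1}x_1.\cdots\lambda^{a_n}x_n.x$) then $A\,@^aB\Rightarrow_{S,n+m}A'[a:=\star][x:=B']$. Full weak superdevelopment $A^{*}_{S,k}$ (a partial function, by induction on $A$): $x^{*}_{S,0}=x$; $(\lambda^a x.A)^{*}_{S,0}=\lambda^a x.A^{*}_{x\cdot S,0}$; $(\lambda^a x.A)^{*}_{S,k+1}=\lambda^a x.A^{*}_{S,k}$; $(A\,@^aB)^{*}_{S,k}=A'[a:=\star][x:=B']$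 if condition $(\star)$ holds, and $(A\,@^aB)^{*}_{S,0}=A^{*}_{S,0}\,@^a B^{*}_{S,0}$ if $(\star)$ fails and $k=0$; undefined otherwise. Condition $(\star)$: there are $n,m\ge0$ with $A^{*}_{S,n+1}=\lambda^a x.A'$ where $A'=\lambda^{a_1}x_1.\cdots\lambda^{a_n}x_n.A''$, $B^{*}_{S,m}=B'=\lambda^{b_1}y_1.\cdots\lambda^{b_m}y_m.B''$, $n+m=k$, ($m>0\Rightarrow A''=x$), and $(\lambda^a x.A')\,@^aB'$ is away from $S$. -}

module Defs where

-- Labeled lambda terms in de Bruijn representation.
--  * term variables: de Bruijn indices counting enclosing λ-binders;
--    free variables are the indices that escape all binders.
--  * labels: de Bruijn indices counting enclosing @-binders (the label of
--    A @^a B binds in A only), plus the distinguished never-bound label ⋆.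
--  * `app A B` is  A @^a B ; the binding label a is anonymous (index 0 in A).
-- Terms up to renaming of bound variables/labels are thus literally equal.

open import Data.Nat using (ℕ; zero; suc; _+_; _<_; _≡ᵇ_)
open import Data.Bool using (if_then_else_)
open import Data.List using (List; _∷_; map)
open import Data.List.Membership.Propositional using (_∈_)
open import Data.Product using (Σ; _×_; ∃)
open import Data.Sum using (_⊎_)
open import Data.Unit using (⊤)
open import Data.Empty using (⊥)
open import Relation.Nullary using (¬_)
open import Relation.Binary.PropositionalEquality using (_≡_)

data Lab : Set where
  ⋆   : Lab
  lab : ℕ → Lab

data Tm : Set where
  var : ℕ → Tm
  lam : Lab → Tm → Tm
  app : Tm → Tm → Tm

extR : (ℕ → ℕ) → ℕ → ℕ
extR ρ zero    = zero
extR ρ (suc i) = suc (ρ i)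

renLab : (ℕ → ℕ) → Lab → Lab
renLab ρ ⋆       = ⋆
renLab ρ (lab i) = lab (ρ i)

renL : (ℕ → ℕ) → Tm → Tm
renL ρ (var x)   = var x
renL ρ (lam a A) = lam (renLab ρ a) (renL ρ A)
renL ρ (app A B) = app (renL (extR ρ) A) (renL ρ B)

renV : (ℕ → ℕ) → Tm → Tm
renV ρ (var x)   = var (ρ x)
renV ρ (lam a A) = lam a (renV (extR ρ) A)
renV ρ (app A B) = app (renV ρ A) (renV ρ B)

extS : (ℕ → Tm) → ℕ → Tm
extS σ zero    = var zero
extS σ (suc i) = renV suc (σ i)

sub : (ℕ → Tm) → Tm → Tm
sub σ (var x)   = σ x
sub σ (lam a A) = lam a (sub (extS σ) A)
sub σ (app A B) = app (sub (λ i → renL suc (σ i)) A) (sub σ B)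

extLS : (ℕ → Lab) → ℕ → Lab
extLS τ zero    = lab zero
extLS τ (suc i) = renLab suc (τ i)

subLab : (ℕ → Lab) → Lab → Lab
subLab τ ⋆       = ⋆
subLab τ (lab i) = τ i

subL : (ℕ → Lab) → Tm → Tm
subL τ (var x)   = var x
subL τ (lam a A) = lam (subLab τ a) (subL τ A)
subL τ (app A B) = app (subL (extLS τ) A) (subL τ B)

-- A [ x := B ] : substitution of a free variable x (no renumbering)
_[_:=_] : Tm → ℕ → Tm → Tm
A [ x := B ] = sub (λ y → if y ≡ᵇ x then B else var y) A

-- contractum  A'[a:=⋆][x:=B']  where a is label index 0 and x is variable
-- index 0 of A' (A' being the body of λ^a x.A' inside A @^a B)
contract : Tm → Tm → Tm
contract A' B' = sub σ (subL τ A')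
  where
  σ : ℕ → Tm
  σ zero    = B'
  σ (suc i) = var i
  τ : ℕ → Lab
  τ zero    = ⋆
  τ (suc i) = lab i

data FreeIn : ℕ → Tm → Set where
  fvar : ∀ {x} → FreeIn x (var x)
  flam : ∀ {x a A} → FreeIn (suc x) A → FreeIn x (lam a A)
  fappˡ : ∀ {x A B} → FreeIn x A → FreeIn x (app A B)
  fappʳ : ∀ {x A B} → FreeIn x B → FreeIn x (app A B)

Seq : Set
Seq = List ℕ

-- the sequence S seen under one λ-binder (same variables)
under : Seq → Seq
under S = map suc S

-- x · S  where x is the variable bound by the λ just entered
bind : Seq → Seq
bind S = zero ∷ map suc S

Away : Seq → Tm → Set
Away S A = ∀ y → FreeIn y A → ¬ (y ∈ S)

Lams : ℕ → Tm → Set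
Lams zero    A         = ⊤
Lams (suc n) (lam a A) = Lams n A
Lams (suc n) (var _)   = ⊥
Lams (suc n) (app _ _) = ⊥

-- Spine n y A : A is λ^{a1}x1. ... λ^{an}xn. y  (y a variable of the
-- context of A, i.e. index n + y inside the n binders)
Spine : ℕ → ℕ → Tm → Set
Spine zero    y A         = A ≡ var y
Spine (suc n) y (lam a A) = Spine n (suc y) A
Spine (suc n) y (var _)   = ⊥
Spine (suc n) y (app _ _) = ⊥

data Step : Seq → ℕ → Tm → Tm → Set where
  st-var  : ∀ {S x} → Step S 0 (var x) (var x)
  st-lam0 : ∀ {S a A A'} → Step (bind S) 0 A A' → Step S 0 (lam a A) (lam a A')
  st-lamS : ∀ {S k a A A'} → Step (under S) k A A' →
            Step S (suc k) (lam a A) (lam a A')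
  st-app  : ∀ {S A A' B B'} → Step S 0 A A' → Step S 0 B B' →
            Step S 0 (app A B) (app A' B')
  st-beta : ∀ {S n m A A' B B'} →
            Step S (suc n) A (lam (lab zero) A') →
            Step S m B B' →
            Away S (app (lam (lab zero) A') B') →
            (0 < m → Spine n zero A') →
            Step S (n + m) (app A B) (contract A' B')

-- full weak superdevelopment as a graph:  Dev A S k C  means  A^*_{S,k} = C
mutual
  Dev : Tm → Seq → ℕ → Tm → Set
  Dev (var x)   S zero    C = C ≡ var x
  Dev (var x)   S (suc k) C = ⊥
  Dev (lam a A) S zero    C = Σ Tm λ A₀ → Dev A (bind S) 0 A₀ × C ≡ lam a A₀
  Dev (lam a A) S (suc k) C = Σ Tm λ A₀ → Dev A (under S) k A₀ × C ≡ lam a A₀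
  Dev (app A B) S k       C =
      CondStar A B S k C
    ⊎ (k ≡ 0 × ¬ (∃ λ C' → CondStar A B S k C')
             × Σ Tm λ A₀ → Σ Tm λ B₀ →
                 Dev A S 0 A₀ × Dev B S 0 B₀ × C ≡ app A₀ B₀)

  CondStar : Tm → Tm → Seq → ℕ → Tm → Set
  CondStar A B S k C =
    Σ ℕ λ n → Σ ℕ λ m → Σ Tm λ A' → Σ Tm λ B' →
      Dev A S (suc n) (lam (lab zero) A') × Lams n A' ×
      Dev B S m B' × Lams m B' ×
      n + m ≡ k ×
      (0 < m → Spine n zero A') ×
      Away S (app (lam (lab zero) A') B') ×
      C ≡ contract A' B'

Defined : Tm → Seq → ℕ → Set
Defined A S k = ∃ λ C → Dev A S k C

-- Variables and labels are de Bruijn indices, so both A[x:=B] and the contractum A'[a:=⋆][x:=B']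
-- are instances of one operation: substitute B for x and rename the other variables by ρ.  The
-- substitution lemma (1) is proved for this operation by induction on A, with the invariant that ρ
-- carries S to S' on the free variables other than x.  The delicate case is a redex A₁ @ A₂ whose
-- result is a spine λ…λ.x: inserting B then moves the split n + m of (⋆), differently according to
-- whether the spine ends in the argument or in the body of the redex.  Two structural facts keep
-- the bookkeeping sound: the superdevelopment is functional, and a result λ…λ.y at level j excludes
-- every higher level, so the split in (⋆) is unique.  Part (2) is an induction on the superstep; at
-- a β-step the contractum instance of (1) identifies (A @ B)* with (A'[a:=⋆][x:=B'])*, the λ-prefix
-- produced by the step fixing the split.

module Submission where

open import Defs
open import Data.Bool using (true; false; if_then_else_)
open import Data.Empty using (⊥; ⊥-elim)
open import Data.List using ([]; _∷_)
open import Data.List.Membership.Propositional using (_∈_)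
open import Data.List.Membership.Propositional.Properties using (∈-map⁺; ∈-map⁻)
open import Data.List.Relation.Binary.Subset.Propositional using (_⊆_)
open import Data.List.Relation.Unary.Any using (here; there)
open import Data.Nat using (ℕ; zero; suc; _+_; _∸_; _<_; _≤_; _≡ᵇ_; z≤n; s≤s; pred)
open import Data.Nat.Properties
open import Data.Product using (Σ; _×_; _,_; proj₁; proj₂)
open import Data.Sum using (_⊎_; inj₁; inj₂)
open import Data.Unit using (⊤; tt)
open import Function using (_∘_; id)
open import Function.Bundles using (_⇔_; mk⇔; Equivalence)
import Function.Properties.Equivalence as ⇔
open import Relation.Binary.Construct.Closure.ReflexiveTransitive using (Star; ε; _◅_)
open import Relation.Binary.Definitions using (tri<; tri≈; tri>)
open import Relation.Binary.PropositionalEquality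
open import Relation.Nullary using (¬_; Dec; yes; no)
open import Relation.Nullary.Decidable using (map′)

m<n∧n+o≤m+p⇒0<p : ∀ {m n} o p → m < n → n + o ≤ m + p → 0 < p
m<n∧n+o≤m+p⇒0<p {m} {n} o zero m<n le =
  ⊥-elim (<⇒≱ m<n (≤-trans (m≤m+n n o) (≤-trans le (≤-reflexive (+-identityʳ m)))))
m<n∧n+o≤m+p⇒0<p o (suc p) _ _ = s≤s z≤n

m≤n∧n+o≡m⇒n≡m∧o≡0 : ∀ {m n o} → m ≤ n → n + o ≡ m → n ≡ m × o ≡ 0
m≤n∧n+o≡m⇒n≡m∧o≡0 {m} {n} {o} m≤n e =
  n≡m , +-cancelˡ-≡ n o 0 (trans e (trans (sym n≡m) (sym (+-identityʳ n))))
  where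
  n≡m : n ≡ m
  n≡m = ≤-antisym (m+n≤o⇒m≤o n (≤-reflexive e)) m≤n


m≡n+o∧0<n⇒0<m : ∀ {m n o} → m ≡ n + o → 0 < n → 0 < m
m≡n+o∧0<n⇒0<m {n = n} {o} e p = subst (0 <_) (sym e) (≤-trans p (m≤m+n n o))

m≡n+o∧0<o⇒0<m : ∀ {m n o} → m ≡ n + o → 0 < o → 0 < m
m≡n+o∧0<o⇒0<m {n = n} {o} e p = subst (0 <_) (sym e) (≤-trans p (m≤n+m o n))

-- Algebra of renamings and substitutions
extR-ext : ∀ {ρ ρ' : ℕ → ℕ} → ρ ≗ ρ' → extR ρ ≗ extR ρ'
extR-ext e zero = refl
extR-ext e (suc i) = cong suc (e i)

renV-ext : ∀ {ρ ρ'} → ρ ≗ ρ' → ∀ t → renV ρ t ≡ renV ρ' t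
renV-ext e (var x) = cong var (e x)
renV-ext e (lam a t) = cong (lam a) (renV-ext (extR-ext e) t)
renV-ext e (app t u) = cong₂ app (renV-ext e t) (renV-ext e u)

renLab-ext : ∀ {ρ ρ'} → ρ ≗ ρ' → ∀ a → renLab ρ a ≡ renLab ρ' a
renLab-ext e ⋆ = refl
renLab-ext e (lab i) = cong lab (e i)

renL-ext : ∀ {ρ ρ'} → ρ ≗ ρ' → ∀ t → renL ρ t ≡ renL ρ' t
renL-ext e (var x) = refl
renL-ext e (lam a t) = cong₂ lam (renLab-ext e a) (renL-ext e t)
renL-ext e (app t u) = cong₂ app (renL-ext (extR-ext e) t) (renL-ext e u)

extS-ext : ∀ {σ σ' : ℕ → Tm} → σ ≗ σ' → extS σ ≗ extS σ'
extS-ext e zero = refl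
extS-ext e (suc i) = cong (renV suc) (e i)

sub-ext : ∀ {σ σ'} → σ ≗ σ' → ∀ t → sub σ t ≡ sub σ' t
sub-ext e (var x) = e x
sub-ext e (lam a t) = cong (lam a) (sub-ext (extS-ext e) t)
sub-ext e (app t u) = cong₂ app (sub-ext (λ i → cong (renL suc) (e i)) t) (sub-ext e u)

extLS-ext : ∀ {τ τ' : ℕ → Lab} → τ ≗ τ' → extLS τ ≗ extLS τ'
extLS-ext e zero = refl
extLS-ext e (suc i) = cong (renLab suc) (e i)

subLab-ext : ∀ {τ τ'} → τ ≗ τ' → ∀ a → subLab τ a ≡ subLab τ' a
subLab-ext e ⋆ = refl
subLab-ext e (lab i) = e i

subL-ext : ∀ {τ τ'} → τ ≗ τ' → ∀ t → subL τ t ≡ subL τ' t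
subL-ext e (var x) = refl
subL-ext e (lam a t) = cong₂ lam (subLab-ext e a) (subL-ext e t)
subL-ext e (app t u) = cong₂ app (subL-ext (extLS-ext e) t) (subL-ext e u)

renV-renV : ∀ ρ ρ' t → renV ρ (renV ρ' t) ≡ renV (ρ ∘ ρ') t
renV-renV ρ ρ' (var x) = refl
renV-renV ρ ρ' (lam a t) = cong (lam a) (trans (renV-renV (extR ρ) (extR ρ') t)
  (renV-ext (λ { zero → refl ; (suc i) → refl }) t))
renV-renV ρ ρ' (app t u) = cong₂ app (renV-renV ρ ρ' t) (renV-renV ρ ρ' u)

renL-renL : ∀ ρ ρ' t → renL ρ (renL ρ' t) ≡ renL (ρ ∘ ρ') t
renL-renL ρ ρ' (var x) = refl
renL-renL ρ ρ' (lam ⋆ t) = cong (lam ⋆) (renL-renL ρ ρ' t)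
renL-renL ρ ρ' (lam (lab i) t) = cong (lam (lab (ρ (ρ' i)))) (renL-renL ρ ρ' t)
renL-renL ρ ρ' (app t u) = cong₂ app (trans (renL-renL (extR ρ) (extR ρ') t)
  (renL-ext (λ { zero → refl ; (suc i) → refl }) t)) (renL-renL ρ ρ' u)

renV-renL : ∀ ρ ρ' t → renV ρ (renL ρ' t) ≡ renL ρ' (renV ρ t)
renV-renL ρ ρ' (var x) = refl
renV-renL ρ ρ' (lam a t) = cong (lam _) (renV-renL (extR ρ) ρ' t)
renV-renL ρ ρ' (app t u) = cong₂ app (renV-renL ρ (extR ρ') t) (renV-renL ρ ρ' u)

sub-renV : ∀ σ ρ t → sub σ (renV ρ t) ≡ sub (σ ∘ ρ) t
sub-renV σ ρ (var x) = refl
sub-renV σ ρ (lam a t) = cong (lam a) (trans (sub-renV (extS σ) (extR ρ) t)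
  (sub-ext (λ { zero → refl ; (suc i) → refl }) t))
sub-renV σ ρ (app t u) = cong₂ app (sub-renV (λ i → renL suc (σ i)) ρ t) (sub-renV σ ρ u)

renV-sub : ∀ ρ σ t → renV ρ (sub σ t) ≡ sub (renV ρ ∘ σ) t
renV-sub ρ σ (var x) = refl
renV-sub ρ σ (lam a t) = cong (lam a) (trans (renV-sub (extR ρ) (extS σ) t)
  (sub-ext (λ { zero → refl ; (suc i) → trans (renV-renV (extR ρ) suc (σ i)) (sym (renV-renV suc ρ (σ i))) }) t))
renV-sub ρ σ (app t u) = cong₂ app (trans (renV-sub ρ (λ i → renL suc (σ i)) t)
  (sub-ext (λ i → renV-renL ρ suc (σ i)) t)) (renV-sub ρ σ u)

renL-renV : ∀ ρ ρ' t → renL ρ (renV ρ' t) ≡ renV ρ' (renL ρ t)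
renL-renV ρ ρ' t = sym (renV-renL ρ' ρ t)

renL-sub : ∀ ρ σ t → renL ρ (sub σ t) ≡ sub (renL ρ ∘ σ) (renL ρ t)
renL-sub ρ σ (var x) = refl
renL-sub ρ σ (lam a t) = cong (lam _) (trans (renL-sub ρ (extS σ) t)
  (sub-ext (λ { zero → refl ; (suc i) → renL-renV ρ suc (σ i) }) (renL ρ t)))
renL-sub ρ σ (app t u) = cong₂ app (trans (renL-sub (extR ρ) (λ i → renL suc (σ i)) t)
  (sub-ext (λ i → trans (renL-renL (extR ρ) suc (σ i)) (sym (renL-renL suc ρ (σ i)))) (renL (extR ρ) t)))
  (renL-sub ρ σ u)

sub-sub : ∀ σ σ' t → sub σ (sub σ' t) ≡ sub (sub σ ∘ σ') t
sub-sub σ σ' (var x) = refl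
sub-sub σ σ' (lam a t) = cong (lam a) (trans (sub-sub (extS σ) (extS σ') t)
  (sub-ext (λ { zero → refl ; (suc i) → trans (sub-renV (extS σ) suc (σ' i)) (sym (renV-sub suc σ (σ' i))) }) t))
sub-sub σ σ' (app t u) = cong₂ app (trans (sub-sub (λ i → renL suc (σ i)) (λ i → renL suc (σ' i)) t)
  (sub-ext (λ i → sym (renL-sub suc σ (σ' i))) t)) (sub-sub σ σ' u)

sub-var : ∀ t → sub var t ≡ t
sub-var (var x) = refl
sub-var (lam a t) = cong (lam a) (trans (sub-ext (λ { zero → refl ; (suc i) → refl }) t) (sub-var t))
sub-var (app t u) = cong₂ app (sub-var t) (sub-var u)

renV-as-sub : ∀ ρ t → renV ρ t ≡ sub (var ∘ ρ) t
renV-as-sub ρ t = trans (sym (sub-var (renV ρ t))) (sub-renV var ρ t)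

subL-renV : ∀ τ ρ t → subL τ (renV ρ t) ≡ renV ρ (subL τ t)
subL-renV τ ρ (var x) = refl
subL-renV τ ρ (lam a t) = cong (lam _) (subL-renV τ (extR ρ) t)
subL-renV τ ρ (app t u) = cong₂ app (subL-renV (extLS τ) ρ t) (subL-renV τ ρ u)

renL-as-subL : ∀ ρ t → renL ρ t ≡ subL (lab ∘ ρ) t
renL-as-subL ρ (var x) = refl
renL-as-subL ρ (lam ⋆ t) = cong (lam ⋆) (renL-as-subL ρ t)
renL-as-subL ρ (lam (lab i) t) = cong (lam _) (renL-as-subL ρ t)
renL-as-subL ρ (app t u) = cong₂ app (trans (renL-as-subL (extR ρ) t)
  (subL-ext (λ { zero → refl ; (suc i) → refl }) t)) (renL-as-subL ρ u)

subLab-subLab : ∀ τ τ' a → subLab τ (subLab τ' a) ≡ subLab (subLab τ ∘ τ') a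
subLab-subLab τ τ' ⋆ = refl
subLab-subLab τ τ' (lab i) = refl

extLS-comp : ∀ τ τ' → subLab (extLS τ) ∘ extLS τ' ≗ extLS (subLab τ ∘ τ')
extLS-comp τ τ' zero = refl
extLS-comp τ τ' (suc i) with τ' i
... | ⋆ = refl
... | lab j = refl

subL-subL : ∀ τ τ' t → subL τ (subL τ' t) ≡ subL (subLab τ ∘ τ') t
subL-subL τ τ' (var x) = refl
subL-subL τ τ' (lam a t) = cong₂ lam (subLab-subLab τ τ' a) (subL-subL τ τ' t)
subL-subL τ τ' (app t u) = cong₂ app (trans (subL-subL (extLS τ) (extLS τ') t)
  (subL-ext (extLS-comp τ τ') t)) (subL-subL τ τ' u)

subLab-lab : ∀ a → subLab lab a ≡ a
subLab-lab ⋆ = refl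
subLab-lab (lab i) = refl

subL-lab : ∀ t → subL lab t ≡ t
subL-lab (var x) = refl
subL-lab (lam a t) = cong₂ lam (subLab-lab a) (subL-lab t)
subL-lab (app t u) = cong₂ app (trans (subL-ext (λ { zero → refl ; (suc i) → refl }) t) (subL-lab t)) (subL-lab u)

subL-renL-suc : ∀ τ t → subL (extLS τ) (renL suc t) ≡ renL suc (subL τ t)
subL-renL-suc τ t = begin
    subL (extLS τ) (renL suc t)
  ≡⟨ cong (subL (extLS τ)) (renL-as-subL suc t) ⟩
    subL (extLS τ) (subL (lab ∘ suc) t)
  ≡⟨ subL-subL (extLS τ) (lab ∘ suc) t ⟩
    subL (subLab (extLS τ) ∘ lab ∘ suc) t
  ≡⟨ subL-ext (λ i → renLab-as-subLab (τ i)) t ⟩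
    subL (subLab (lab ∘ suc) ∘ τ) t
  ≡⟨ sym (subL-subL (lab ∘ suc) τ t) ⟩
    subL (lab ∘ suc) (subL τ t)
  ≡⟨ sym (renL-as-subL suc (subL τ t)) ⟩
    renL suc (subL τ t) ∎
  where
  open ≡-Reasoning
  renLab-as-subLab : ∀ a → renLab suc a ≡ subLab (lab ∘ suc) a
  renLab-as-subLab ⋆ = refl
  renLab-as-subLab (lab i) = refl

subL-sub : ∀ τ σ t → subL τ (sub σ t) ≡ sub (subL τ ∘ σ) (subL τ t)
subL-sub τ σ (var x) = refl
subL-sub τ σ (lam a t) = cong (lam _) (trans (subL-sub τ (extS σ) t)
  (sub-ext (λ { zero → refl ; (suc i) → subL-renV τ suc (σ i) }) (subL τ t)))
subL-sub τ σ (app t u) = cong₂ app (trans (subL-sub (extLS τ) (λ i → renL suc (σ i)) t)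
  (sub-ext (λ i → subL-renL-suc τ (σ i)) (subL (extLS τ) t))) (subL-sub τ σ u)


-- Substitution with renaming
-- A [ x := B ] is sub (subRen x B id) A on the nose, and contract A' B' is sub (subRen 0 B' pred)
-- after subL star₀ (contract-as-sub); the substitution lemma is proved for subRen in general.
subRen : ℕ → Tm → (ℕ → ℕ) → ℕ → Tm
subRen x B ρ y = if y ≡ᵇ x then B else var (ρ y)

sub₀ : Tm → ℕ → Tm
sub₀ B = subRen 0 B pred

star₀ : ℕ → Lab
star₀ zero = ⋆
star₀ (suc i) = lab i

contract-as-sub : ∀ A B → contract A B ≡ sub (sub₀ B) (subL star₀ A)
contract-as-sub A B = unfold (λ { zero → refl ; (suc i) → refl }) (λ { zero → refl ; (suc i) → refl })
  where
  unfold : ∀ {σ τ} → σ ≗ sub₀ B → τ ≗ star₀ → sub σ (subL τ A) ≡ sub (sub₀ B) (subL star₀ A)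
  unfold eσ eτ = trans (sub-ext eσ (subL _ A)) (cong (sub (sub₀ B)) (subL-ext eτ A))

sub₀-renV-suc : ∀ B t → sub (sub₀ B) (renV suc t) ≡ t
sub₀-renV-suc B t = trans (sub-renV (sub₀ B) suc t) (sub-var t)

star₀-renL-suc : ∀ t → subL star₀ (renL suc t) ≡ t
star₀-renL-suc t = trans (cong (subL star₀) (renL-as-subL suc t))
  (trans (subL-subL star₀ (lab ∘ suc) t) (subL-lab t))

sub-contract : ∀ σ X Y → sub σ (contract X Y) ≡ contract (sub (extS (renL suc ∘ σ)) X) (sub σ Y)
sub-contract σ X Y = begin
    sub σ (contract X Y)
  ≡⟨ cong (sub σ) (contract-as-sub X Y) ⟩
    sub σ (sub (sub₀ Y) (subL star₀ X))
  ≡⟨ sub-sub σ (sub₀ Y) (subL star₀ X) ⟩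
    sub (sub σ ∘ sub₀ Y) (subL star₀ X)
  ≡⟨ sub-ext (λ { zero → refl ; (suc i) → sym (sub₀-renV-suc (sub σ Y) (σ i)) }) (subL star₀ X) ⟩
    sub (sub (sub₀ (sub σ Y)) ∘ extS σ) (subL star₀ X)
  ≡⟨ sym (sub-sub (sub₀ (sub σ Y)) (extS σ) (subL star₀ X)) ⟩
    sub (sub₀ (sub σ Y)) (sub (extS σ) (subL star₀ X))
  ≡⟨ cong (sub (sub₀ (sub σ Y))) (sub-ext (λ { zero → refl ; (suc i) → star₀-renV-suc (σ i) }) (subL star₀ X)) ⟩
    sub (sub₀ (sub σ Y)) (sub (subL star₀ ∘ extS (renL suc ∘ σ)) (subL star₀ X))
  ≡⟨ cong (sub (sub₀ (sub σ Y))) (sym (subL-sub star₀ (extS (renL suc ∘ σ)) X)) ⟩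
    sub (sub₀ (sub σ Y)) (subL star₀ (sub (extS (renL suc ∘ σ)) X))
  ≡⟨ sym (contract-as-sub (sub (extS (renL suc ∘ σ)) X) (sub σ Y)) ⟩
    contract (sub (extS (renL suc ∘ σ)) X) (sub σ Y) ∎
  where
  open ≡-Reasoning
  star₀-renV-suc : ∀ t → renV suc t ≡ subL star₀ (renV suc (renL suc t))
  star₀-renV-suc t = trans (cong (renV suc) (sym (star₀-renL-suc t))) (sym (subL-renV star₀ suc (renL suc t)))

subL-contract : ∀ τ X Y → subL τ (contract X Y) ≡ contract (subL (extLS τ) X) (subL τ Y)
subL-contract τ X Y = begin
    subL τ (contract X Y)
  ≡⟨ cong (subL τ) (contract-as-sub X Y) ⟩
    subL τ (sub (sub₀ Y) (subL star₀ X))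
  ≡⟨ subL-sub τ (sub₀ Y) (subL star₀ X) ⟩
    sub (subL τ ∘ sub₀ Y) (subL τ (subL star₀ X))
  ≡⟨ sub-ext (λ { zero → refl ; (suc i) → refl }) (subL τ (subL star₀ X)) ⟩
    sub (sub₀ (subL τ Y)) (subL τ (subL star₀ X))
  ≡⟨ cong (sub (sub₀ (subL τ Y))) (trans (subL-subL τ star₀ X) (trans (subL-ext star₀-extLS X) (sym (subL-subL star₀ (extLS τ) X)))) ⟩
    sub (sub₀ (subL τ Y)) (subL star₀ (subL (extLS τ) X))
  ≡⟨ sym (contract-as-sub (subL (extLS τ) X) (subL τ Y)) ⟩
    contract (subL (extLS τ) X) (subL τ Y) ∎
  where
  open ≡-Reasoning
  star₀-extLS : subLab τ ∘ star₀ ≗ subLab star₀ ∘ extLS τ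
  star₀-extLS zero = refl
  star₀-extLS (suc i) with τ i
  ... | ⋆ = refl
  ... | lab j = refl


-- Free variables
var-inj : ∀ {x y} → var x ≡ var y → x ≡ y
var-inj refl = refl

fv-renV⁺ : ∀ ρ {z t} → FreeIn z t → FreeIn (ρ z) (renV ρ t)
fv-renV⁺ ρ fvar = fvar
fv-renV⁺ ρ (flam f) = flam (fv-renV⁺ (extR ρ) f)
fv-renV⁺ ρ (fappˡ f) = fappˡ (fv-renV⁺ ρ f)
fv-renV⁺ ρ (fappʳ f) = fappʳ (fv-renV⁺ ρ f)

fv-renV⁻ : ∀ ρ {y} t → FreeIn y (renV ρ t) → Σ ℕ λ z → FreeIn z t × ρ z ≡ y
fv-renV⁻ ρ (var x) fvar = x , fvar , refl
fv-renV⁻ ρ (lam a t) (flam f) with fv-renV⁻ (extR ρ) t f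
... | zero , g , ()
... | suc z , g , e = z , flam g , suc-injective e
fv-renV⁻ ρ (app t u) (fappˡ f) with fv-renV⁻ ρ t f
... | z , g , e = z , fappˡ g , e
fv-renV⁻ ρ (app t u) (fappʳ f) with fv-renV⁻ ρ u f
... | z , g , e = z , fappʳ g , e

fv-subL⁺ : ∀ τ {z t} → FreeIn z t → FreeIn z (subL τ t)
fv-subL⁺ τ fvar = fvar
fv-subL⁺ τ (flam f) = flam (fv-subL⁺ τ f)
fv-subL⁺ τ (fappˡ f) = fappˡ (fv-subL⁺ (extLS τ) f)
fv-subL⁺ τ (fappʳ f) = fappʳ (fv-subL⁺ τ f)

fv-subL⁻ : ∀ τ {z} t → FreeIn z (subL τ t) → FreeIn z t
fv-subL⁻ τ (var x) fvar = fvar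
fv-subL⁻ τ (lam a t) (flam f) = flam (fv-subL⁻ τ t f)
fv-subL⁻ τ (app t u) (fappˡ f) = fappˡ (fv-subL⁻ (extLS τ) t f)
fv-subL⁻ τ (app t u) (fappʳ f) = fappʳ (fv-subL⁻ τ u f)

fv-renL⁺ : ∀ ρ {z} t → FreeIn z t → FreeIn z (renL ρ t)
fv-renL⁺ ρ t f = subst (FreeIn _) (sym (renL-as-subL ρ t)) (fv-subL⁺ _ f)

fv-renL⁻ : ∀ ρ {z} t → FreeIn z (renL ρ t) → FreeIn z t
fv-renL⁻ ρ t f = fv-subL⁻ _ t (subst (FreeIn _) (renL-as-subL ρ t) f)

fv-sub⁺ : ∀ σ {z y t} → FreeIn z t → FreeIn y (σ z) → FreeIn y (sub σ t)
fv-sub⁺ σ fvar g = g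
fv-sub⁺ σ (flam f) g = flam (fv-sub⁺ (extS σ) f (fv-renV⁺ suc g))
fv-sub⁺ σ {z} {y} {app t u} (fappˡ f) g = fappˡ (fv-sub⁺ (λ i → renL suc (σ i)) f (fv-renL⁺ suc (σ z) g))
fv-sub⁺ σ (fappʳ f) g = fappʳ (fv-sub⁺ σ f g)

fv-sub⁻ : ∀ σ {y} t → FreeIn y (sub σ t) → Σ ℕ λ z → FreeIn z t × FreeIn y (σ z)
fv-sub⁻ σ (var x) f = x , fvar , f
fv-sub⁻ σ (lam a t) (flam f) with fv-sub⁻ (extS σ) t f
... | zero , g , ()
... | suc z , g , h with fv-renV⁻ suc (σ z) h
... | w , h' , refl = z , flam g , h'
fv-sub⁻ σ (app t u) (fappˡ f) with fv-sub⁻ (λ i → renL suc (σ i)) t f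
... | z , g , h = z , fappˡ g , fv-renL⁻ suc (σ z) h
fv-sub⁻ σ (app t u) (fappʳ f) with fv-sub⁻ σ u f
... | z , g , h = z , fappʳ g , h

sub-agree : ∀ {σ σ'} t → (∀ z → FreeIn z t → σ z ≡ σ' z) → sub σ t ≡ sub σ' t
sub-agree (var x) e = e x fvar
sub-agree (lam a t) e = cong (lam a) (sub-agree t λ { zero f → refl ; (suc z) f → cong (renV suc) (e z (flam f)) })
sub-agree (app t u) e = cong₂ app (sub-agree t (λ z f → cong (renL suc) (e z (fappˡ f)))) (sub-agree u (λ z f → e z (fappʳ f)))

fv-contract⁻ : ∀ {y} X Y → FreeIn y (contract X Y) → FreeIn (suc y) X ⊎ FreeIn y Y
fv-contract⁻ X Y f with fv-sub⁻ (sub₀ Y) (subL star₀ X) (subst (FreeIn _) (contract-as-sub X Y) f)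
... | zero , g , h = inj₂ h
... | suc z , g , fvar = inj₁ (fv-subL⁻ star₀ X g)

contract-irrel : ∀ X Y Y' → ¬ FreeIn zero X → contract X Y ≡ contract X Y'
contract-irrel X Y Y' nf = trans (contract-as-sub X Y) (trans
  (sub-agree (subL star₀ X) (λ { zero f → ⊥-elim (nf (fv-subL⁻ star₀ X f)) ; (suc z) f → refl }))
  (sym (contract-as-sub X Y')))


-- λ-prefixes and spines
spine-unique : ∀ {n n' a b} X → Spine n a X → Spine n' b X → n ≡ n' × a ≡ b
spine-unique {zero} {zero} X refl refl = refl , refl
spine-unique {zero} {suc n'} (lam _ _) () q
spine-unique {suc n} {zero} (lam _ _) p ()
spine-unique {suc n} {suc n'} {a} {b} (lam _ X) p q with spine-unique {n} {n'} {suc a} {suc b} X p q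
... | refl , refl = refl , refl

spine-lams : ∀ {n a} X → Spine n a X → Lams n X
spine-lams {zero} X p = tt
spine-lams {suc n} {a} (lam _ X) p = spine-lams {n} {suc a} X p

spine-lams-le : ∀ {p v n} X → Spine p v X → Lams n X → n ≤ p
spine-lams-le {p} {v} {zero} X s l = z≤n
spine-lams-le {zero} {v} {suc n} X refl ()
spine-lams-le {suc p} {v} {suc n} (lam _ X) s l = s≤s (spine-lams-le {p} {suc v} {n} X s l)

lams-subL : ∀ {n} τ X → Lams n X → Lams n (subL τ X)
lams-subL {zero} τ X l = tt
lams-subL {suc n} τ (lam a X) l = lams-subL {n} τ X l

lams-sub : ∀ {n} σ X → Lams n X → Lams n (sub σ X)
lams-sub {zero} σ X l = tt
lams-sub {suc n} σ (lam a X) l = lams-sub {n} (extS σ) X l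

lams-renV⁺ : ∀ {n} ρ X → Lams n X → Lams n (renV ρ X)
lams-renV⁺ {zero} ρ X l = tt
lams-renV⁺ {suc n} ρ (lam a X) l = lams-renV⁺ {n} (extR ρ) X l

lams-renV⁻ : ∀ {n} ρ X → Lams n (renV ρ X) → Lams n X
lams-renV⁻ {zero} ρ X l = tt
lams-renV⁻ {suc n} ρ (lam a X) l = lams-renV⁻ {n} (extR ρ) X l
lams-renV⁻ {suc n} ρ (var x) ()
lams-renV⁻ {suc n} ρ (app X X₁) ()

lams-subL⁻ : ∀ {n} τ X → Lams n (subL τ X) → Lams n X
lams-subL⁻ {zero} τ X l = tt
lams-subL⁻ {suc n} τ (lam a X) l = lams-subL⁻ {n} τ X l
lams-subL⁻ {suc n} τ (var x) ()
lams-subL⁻ {suc n} τ (app X X₁) ()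

lams-renL : ∀ {n} ρ X → Lams n X → Lams n (renL ρ X)
lams-renL {n} ρ X l = subst (Lams n) (sym (renL-as-subL ρ X)) (lams-subL {n} (lab ∘ ρ) X l)

spine-renV⁺ : ∀ {q w} ρ t → Spine q w t → Spine q (ρ w) (renV ρ t)
spine-renV⁺ {zero} ρ t refl = refl
spine-renV⁺ {suc q} {w} ρ (lam a t) s = spine-renV⁺ {q} {suc w} (extR ρ) t s

spine-renV⁻ : ∀ {q y} ρ t → Spine q y (renV ρ t) → Σ ℕ λ w → Spine q w t × ρ w ≡ y
spine-renV⁻ {zero} ρ (var x) refl = x , refl , refl
spine-renV⁻ {zero} ρ (lam a t) ()
spine-renV⁻ {zero} ρ (app t t₁) ()
spine-renV⁻ {suc q} {y} ρ (lam a t) s with spine-renV⁻ {q} {suc y} (extR ρ) t s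
... | zero , s' , ()
... | suc w , s' , e = w , s' , suc-injective e

spine-subL⁺ : ∀ {q y} τ t → Spine q y t → Spine q y (subL τ t)
spine-subL⁺ {zero} τ t refl = refl
spine-subL⁺ {suc q} {y} τ (lam a t) s = spine-subL⁺ {q} {suc y} τ t s

spine-subL⁻ : ∀ {q y} τ t → Spine q y (subL τ t) → Spine q y t
spine-subL⁻ {zero} τ (var x) refl = refl
spine-subL⁻ {zero} τ (lam a t) ()
spine-subL⁻ {zero} τ (app t t₁) ()
spine-subL⁻ {suc q} {y} τ (lam a t) s = spine-subL⁻ {q} {suc y} τ t s

spine-sub⁺ : ∀ {p q v y} σ X → Spine p v X → Spine q y (σ v) → Spine (p + q) y (sub σ X)
spine-sub⁺ {zero} σ (var x) refl s = s
spine-sub⁺ {suc p} {q} {v} {y} σ (lam a X) sp s = spine-sub⁺ {p} {q} {suc v} {suc y} (extS σ) X sp (spine-renV⁺ {q} {y} suc (σ v) s)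

¬spine-var₀ : ∀ q y → ¬ Spine q (suc y) (var zero)
¬spine-var₀ zero y ()
¬spine-var₀ (suc q) y ()

spine-sub⁻ : ∀ {j y} σ X → Spine j y (sub σ X) →
  Σ ℕ λ p → Σ ℕ λ q → Σ ℕ λ v → p + q ≡ j × Spine p v X × Spine q y (σ v)
spine-sub⁻ σ (var x) s = zero , _ , x , refl , refl , s
spine-sub⁻ {zero} σ (lam a X) ()
spine-sub⁻ {suc j} {y} σ (lam a X) s with spine-sub⁻ {j} {suc y} (extS σ) X s
... | p , q , zero , e , sp , sq = ⊥-elim (¬spine-var₀ q _ sq)
... | p , q , suc v , e , sp , sq with spine-renV⁻ {q} {suc y} suc (σ v) sq
... | w , sw , refl = suc p , q , v , cong suc e , sp , sw
spine-sub⁻ {zero} σ (app X X₁) ()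
spine-sub⁻ {suc j} σ (app X X₁) ()

lams-sub-spine : ∀ {p q v} σ X → Spine p v X → Lams q (σ v) → Lams (p + q) (sub σ X)
lams-sub-spine {zero} σ (var x) refl l = l
lams-sub-spine {suc p} {q} {v} σ (lam a X) sp l = lams-sub-spine {p} {q} {suc v} (extS σ) X sp (lams-renV⁺ {q} suc (σ v) l)

spine-contract-arg : ∀ {n m y} X Y → Spine n zero X → Spine m y Y → Spine (n + m) y (contract X Y)
spine-contract-arg {n} {m} {y} X Y sx sy = subst (Spine (n + m) y) (sym (contract-as-sub X Y))
  (spine-sub⁺ {n} {m} {zero} {y} (sub₀ Y) (subL star₀ X) (spine-subL⁺ {n} {zero} star₀ X sx) sy)

spine-contract-body : ∀ {n y} X Y → Spine n (suc y) X → Spine n y (contract X Y)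
spine-contract-body {n} {y} X Y sx = subst (Spine n y) (sym (contract-as-sub X Y))
  (subst (λ k → Spine k y (sub (sub₀ Y) (subL star₀ X))) (+-identityʳ n)
    (spine-sub⁺ {n} {zero} {suc y} {y} (sub₀ Y) (subL star₀ X) (spine-subL⁺ {n} {suc y} star₀ X sx) refl))

lams-contract : ∀ {n} X Y → Lams n X → Lams n (contract X Y)
lams-contract {n} X Y l = subst (Lams n) (sym (contract-as-sub X Y)) (lams-sub {n} (sub₀ Y) (subL star₀ X) (lams-subL {n} star₀ X l))

lams-contract-spine : ∀ {n m} X Y → Spine n zero X → Lams m Y → Lams (n + m) (contract X Y)
lams-contract-spine {n} {m} X Y s l = subst (Lams (n + m)) (sym (contract-as-sub X Y))
  (lams-sub-spine {n} {m} {zero} (sub₀ Y) (subL star₀ X) (spine-subL⁺ {n} {zero} star₀ X s) l)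

spine-contract⁻ : ∀ {n m y} X Y → Lams n X → (0 < m → Spine n zero X) → Spine (n + m) y (contract X Y) →
      (Spine n zero X × Spine m y Y) ⊎ (m ≡ 0 × Spine n (suc y) X)
spine-contract⁻ {n} {m} {y} X Y l sp s with spine-sub⁻ {n + m} {y} (sub₀ Y) (subL star₀ X) (subst (Spine (n + m) y) (contract-as-sub X Y) s)
... | p , q , v , e , s1 , s2 with spine-subL⁻ {p} {v} star₀ X s1
... | s1' with spine-lams-le {p} {v} {n} X s1' l
spine-contract⁻ {n} {zero} {y} X Y l sp s | p , q , zero , e , s1 , s2 | s1' | le
  with m≤n∧n+o≡m⇒n≡m∧o≡0 le (trans e (+-identityʳ n))
... | refl , refl = inj₁ (s1' , s2)
spine-contract⁻ {n} {suc m} {y} X Y l sp s | p , q , zero , e , s1 , s2 | s1' | le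
  with spine-unique {n} {p} X (sp (s≤s z≤n)) s1'
... | refl , _ = inj₁ (s1' , subst (λ k → Spine k y Y) (+-cancelˡ-≡ n q (suc m) e) s2)
spine-contract⁻ {n} {m} {y} X Y l sp s | p , zero , suc w , e , s1 , refl | s1' | le with m
... | zero = inj₂ (refl , subst (λ k → Spine k (suc y) X) (trans e (+-identityʳ n)) (subst (λ k → Spine k (suc y) X) (sym (+-identityʳ p)) s1'))
... | suc m' with spine-unique {n} {p} X (sp (s≤s z≤n)) s1'
... | _ , ()
spine-contract⁻ {n} {m} {y} X Y l sp s | p , suc q , suc w , e , s1 , () | s1' | le

VarSpine : ℕ → Tm → Set
VarSpine zero (var _) = ⊤
VarSpine zero (lam _ _) = ⊥
VarSpine zero (app _ _) = ⊥
VarSpine (suc n) (lam _ A) = VarSpine n A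
VarSpine (suc n) (var _) = ⊥
VarSpine (suc n) (app _ _) = ⊥

spine⇒varSpine : ∀ {j y} C → Spine j y C → VarSpine j C
spine⇒varSpine {zero} (var x) refl = tt
spine⇒varSpine {suc j} {y} (lam a C) s = spine⇒varSpine {j} {suc y} C s

varSpine-lams-≤ : ∀ {p n} X → VarSpine p X → Lams n X → n ≤ p
varSpine-lams-≤ {p} {zero} X s l = z≤n
varSpine-lams-≤ {zero} {suc n} (var x) s ()
varSpine-lams-≤ {suc p} {suc n} (lam a X) s l = s≤s (varSpine-lams-≤ {p} {n} X s l)

varSpine-spine-≡ : ∀ {n v p} X → Spine n v X → VarSpine p X → p ≡ n
varSpine-spine-≡ {zero} {v} {zero} X s a = refl
varSpine-spine-≡ {zero} {v} {suc p} (var x) s ()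
varSpine-spine-≡ {suc n} {v} {zero} (lam _ X) s ()
varSpine-spine-≡ {suc n} {v} {suc p} (lam _ X) s a = cong suc (varSpine-spine-≡ {n} {suc v} {p} X s a)

varSpine-renV⁻ : ∀ {q} ρ t → VarSpine q (renV ρ t) → VarSpine q t
varSpine-renV⁻ {zero} ρ (var x) s = tt
varSpine-renV⁻ {suc q} ρ (lam a t) s = varSpine-renV⁻ {q} (extR ρ) t s

varSpine-subL⁻ : ∀ {q} τ t → VarSpine q (subL τ t) → VarSpine q t
varSpine-subL⁻ {zero} τ (var x) s = tt
varSpine-subL⁻ {suc q} τ (lam a t) s = varSpine-subL⁻ {q} τ t s

varSpine-sub⁻ : ∀ j σ X → VarSpine j (sub σ X) →
  Σ ℕ λ p → p ≤ j × VarSpine p X × (∀ v → Spine p v X → VarSpine (j ∸ p) (σ v))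
varSpine-sub⁻ j σ (var x) s = zero , z≤n , tt , λ { v refl → s }
varSpine-sub⁻ (suc j) σ (lam a X) s with varSpine-sub⁻ j (extS σ) X s
... | p , le , sX , f = suc p , s≤s le , sX , λ v sp → varSpine-renV⁻ {j ∸ p} suc (σ v) (f (suc v) sp)
varSpine-sub⁻ zero σ (lam a X) ()
varSpine-sub⁻ zero σ (app X Y) ()
varSpine-sub⁻ (suc j) σ (app X Y) ()

varSpine-contract⁻ : ∀ {n m} X Y → Lams n X → (0 < m → Spine n zero X) → VarSpine (n + m) (contract X Y) →
      VarSpine n X × (Spine n zero X → VarSpine m Y)
varSpine-contract⁻ {n} {m} X Y l sp s with varSpine-sub⁻ (n + m) (sub₀ Y) (subL star₀ X) (subst (VarSpine (n + m)) (contract-as-sub X Y) s)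
... | p , le , sX , f = subst (λ k → VarSpine k X) pn sX' ,
      λ s0 → subst (λ k → VarSpine k Y) (trans (cong (n + m ∸_) pn) (m+n∸m≡n n m))
               (f zero (spine-subL⁺ {p} {zero} star₀ X (subst (λ k → Spine k zero X) (sym pn) s0)))
  where
  sX' : VarSpine p X
  sX' = varSpine-subL⁻ {p} star₀ X sX
  n≤p : n ≤ p
  n≤p = varSpine-lams-≤ {p} {n} X sX' l
  pinch : ∀ m → p ≤ n + m → (0 < m → Spine n zero X) → p ≡ n
  pinch zero p≤n _ = ≤-antisym (subst (p ≤_) (+-identityʳ n) p≤n) n≤p
  pinch (suc _) _ sp = varSpine-spine-≡ {n} {zero} {p} X (sp (s≤s z≤n)) sX'
  pn : p ≡ n
  pn = pinch m le sp

lam-inj : ∀ {a b A B} → lam a A ≡ lam b B → A ≡ B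
lam-inj refl = refl


-- Elementary properties of the superdevelopment
dev-lams : ∀ T S k C → Dev T S k C → Lams k C
dev-lams (var x) S zero C d = tt
dev-lams (lam a T) S zero C d = tt
dev-lams (lam a T) S (suc k) C (A₀ , d , refl) = dev-lams T (under S) k A₀ d
dev-lams (app A B) S k C (inj₁ (n , zero , A' , B' , dA , lA , dB , lB , refl , sp , aw , refl)) =
  subst (λ j → Lams j (contract A' B')) (sym (+-identityʳ n)) (lams-contract {n} A' B' lA)
dev-lams (app A B) S k C (inj₁ (n , suc m , A' , B' , dA , lA , dB , lB , refl , sp , aw , refl)) =
  lams-contract-spine {n} {suc m} A' B' (sp (s≤s z≤n)) lB
dev-lams (app A B) S k C (inj₂ (refl , _)) = tt

dev-fv : ∀ T S k C {y} → Dev T S k C → FreeIn y C → FreeIn y T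
dev-fv (var x) S zero C refl f = f
dev-fv (lam a T) S zero C (A₀ , d , refl) (flam f) = flam (dev-fv T (bind S) 0 A₀ d f)
dev-fv (lam a T) S (suc k) C (A₀ , d , refl) (flam f) = flam (dev-fv T (under S) k A₀ d f)
dev-fv (app A B) S k C (inj₁ (n , m , A' , B' , dA , lA , dB , lB , e , sp , aw , refl)) f with fv-contract⁻ A' B' f
... | inj₁ g = fappˡ (dev-fv A S (suc n) (lam (lab zero) A') dA (flam g))
... | inj₂ g = fappʳ (dev-fv B S m B' dB g)
dev-fv (app A B) S k C (inj₂ (_ , _ , A₀ , B₀ , dA , dB , refl)) (fappˡ f) = fappˡ (dev-fv A S 0 A₀ dA f)
dev-fv (app A B) S k C (inj₂ (_ , _ , A₀ , B₀ , dA , dB , refl)) (fappʳ f) = fappʳ (dev-fv B S 0 B₀ dB f)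

dev-spine⁻ : ∀ j y T S i C → Spine j y T → Dev T S i C → i ≤ j × C ≡ T
dev-spine⁻ zero y (var .y) S zero C refl refl = z≤n , refl
dev-spine⁻ (suc j) y (lam a T) S zero C s (A₀ , d , refl) with dev-spine⁻ j (suc y) T (bind S) 0 A₀ s d
... | _ , refl = z≤n , refl
dev-spine⁻ (suc j) y (lam a T) S (suc i) C s (A₀ , d , refl) with dev-spine⁻ j (suc y) T (under S) i A₀ s d
... | le , refl = s≤s le , refl

dev-spine : ∀ j y T S i → Spine j y T → i ≤ j → Dev T S i T
dev-spine zero y (var .y) S zero refl z≤n = refl
dev-spine (suc j) y (lam a T) S zero s le = T , dev-spine j (suc y) T (bind S) 0 s z≤n , refl
dev-spine (suc j) y (lam a T) S (suc i) s (s≤s le) = T , dev-spine j (suc y) T (under S) i s le , refl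

dev-spine-split-≤ : ∀ {n m n₂ m₂} A' S X → (0 < m → Spine n zero A') → Dev A' S n₂ X →
  n ≤ n₂ → n + m ≤ n₂ + m₂ → m ≤ m₂
dev-spine-split-≤ {n} {m} {n₂} {m₂} A' S X sp d n≤n₂ le with m ≤? m₂
... | yes m≤m₂ = m≤m₂
... | no m≰m₂ with dev-spine⁻ n zero A' S n₂ X (sp (≤-<-trans z≤n (≰⇒> m≰m₂))) d
... | n₂≤n , _ with ≤-antisym n≤n₂ n₂≤n
... | refl = +-cancelˡ-≤ n m m₂ le

dev-preserves-lams : ∀ j T S i C → Lams j T → Dev T S i C → i ≤ j → Lams j C
dev-preserves-lams zero T S i C l d le = tt
dev-preserves-lams (suc j) (lam a T) S zero C l (A₀ , d , refl) le = dev-preserves-lams j T (bind S) 0 A₀ l d z≤n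
dev-preserves-lams (suc j) (lam a T) S (suc i) C l (A₀ , d , refl) (s≤s le) = dev-preserves-lams j T (under S) i A₀ l d le

mutual
  dev-functional : ∀ T S k C D → Dev T S k C → Dev T S k D → C ≡ D
  dev-functional (var x) S zero C D refl refl = refl
  dev-functional (lam a T) S zero C D (A₀ , d , refl) (A₁ , d' , refl) = cong (lam a) (dev-functional T (bind S) 0 A₀ A₁ d d')
  dev-functional (lam a T) S (suc k) C D (A₀ , d , refl) (A₁ , d' , refl) = cong (lam a) (dev-functional T (under S) k A₀ A₁ d d')
  dev-functional (app A B) S k C D (inj₁ c₁) (inj₁ c₂) = condStar-functional A B S k C D c₁ c₂
  dev-functional (app A B) S k C D (inj₁ c₁) (inj₂ (_ , ¬c , _)) = ⊥-elim (¬c (C , c₁))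
  dev-functional (app A B) S k C D (inj₂ (_ , ¬c , _)) (inj₁ c₂) = ⊥-elim (¬c (D , c₂))
  dev-functional (app A B) S k C D (inj₂ (_ , _ , A₀ , B₀ , dA , dB , refl)) (inj₂ (_ , _ , A₁ , B₁ , dA' , dB' , refl)) =
    cong₂ app (dev-functional A S 0 A₀ A₁ dA dA') (dev-functional B S 0 B₀ B₁ dB dB')

  condStar-functional : ∀ A B S k C D → CondStar A B S k C → CondStar A B S k D → C ≡ D
  condStar-functional A B S k C D (n , m , A' , B' , dA , lA , dB , lB , e , sp , aw , refl) (n' , m' , A'' , B'' , dA' , lA' , dB' , lB' , e' , sp' , aw' , refl) with <-cmp n n'
  ... | tri≈ _ refl _ with +-cancelˡ-≡ n m m' (trans e (sym e'))
  ... | refl = cong₂ contract (lam-inj (dev-functional A S (suc n) _ _ dA dA')) (dev-functional B S m B' B'' dB dB')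
  condStar-functional A B S k C D (n , m , A' , B' , dA , lA , dB , lB , e , sp , aw , refl) (n' , m' , A'' , B'' , dA' , lA' , dB' , lB' , e' , sp' , aw' , refl) | tri< lt _ _ =
    ⊥-elim (varSpine-dev-maximal A S (suc n) (suc n') (lam (lab zero) A') (lam (lab zero) A'') dA
      (spine⇒varSpine {n} {zero} A' (sp (m<n∧n+o≤m+p⇒0<p m' m lt (≤-reflexive (trans e' (sym e)))))) (s≤s lt) dA')
  condStar-functional A B S k C D (n , m , A' , B' , dA , lA , dB , lB , e , sp , aw , refl) (n' , m' , A'' , B'' , dA' , lA' , dB' , lB' , e' , sp' , aw' , refl) | tri> _ _ gt =
    ⊥-elim (varSpine-dev-maximal A S (suc n') (suc n) (lam (lab zero) A'') (lam (lab zero) A') dA'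
      (spine⇒varSpine {n'} {zero} A'' (sp' (m<n∧n+o≤m+p⇒0<p m m' gt (≤-reflexive (trans e (sym e')))))) (s≤s gt) dA)

  varSpine-dev-maximal : ∀ T S j j' C D → Dev T S j C → VarSpine j C → j < j' → Dev T S j' D → ⊥
  varSpine-dev-maximal (var x) S zero (suc j') C D d s lt ()
  varSpine-dev-maximal (lam a T) S zero j' C D (A₀ , d , refl) () lt d'
  varSpine-dev-maximal (lam a T) S (suc j) (suc j') C D (A₀ , d , refl) s (s≤s lt) (A₁ , d' , refl) = varSpine-dev-maximal T (under S) j j' A₀ A₁ d s lt d'
  varSpine-dev-maximal (app A B) S j j' C D (inj₂ (refl , _ , A₀ , B₀ , dA , dB , refl)) () lt d'
  varSpine-dev-maximal (app A B) S j j' C D (inj₁ c) s lt (inj₂ (refl , _)) = n≮0 lt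
  varSpine-dev-maximal (app A B) S j j' C D (inj₁ (n , m , A' , B' , dA , lA , dB , lB , refl , spc , aw , refl)) s lt
     (inj₁ (n' , m' , A'' , B'' , dA' , lA' , dB' , lB' , refl , spc' , aw' , refl))
     with varSpine-contract⁻ {n} {m} A' B' lA spc s | <-cmp n n'
  ... | sA' , f | tri< n<n' _ _ = varSpine-dev-maximal A S (suc n) (suc n') (lam (lab zero) A') _ dA sA' (s≤s n<n') dA'
  ... | sA' , f | tri≈ _ refl _ with dev-functional A S (suc n) _ _ dA dA'
  ... | refl = varSpine-dev-maximal B S m m' B' B'' dB (f (spc' (≤-<-trans z≤n m<m'))) m<m' dB'
    where m<m' = +-cancelˡ-< n m m' lt
  varSpine-dev-maximal (app A B) S j j' C D (inj₁ (n , m , A' , B' , dA , lA , dB , lB , refl , spc , aw , refl)) s lt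
     (inj₁ (n' , m' , A'' , B'' , dA' , lA' , dB' , lB' , refl , spc' , aw' , refl))
     | sA' , f | tri> _ _ n'<n = varSpine-dev-maximal A S (suc n') (suc n) (lam (lab zero) A'') _ dA'
         (spine⇒varSpine {n'} {zero} A'' (spc' (pos))) (s≤s n'<n) dA
    where
    pos : 0 < m'
    pos = m<n∧n+o≤m+p⇒0<p m m' n'<n (<⇒≤ lt)


-- Decidability, and totality at level 0
freeIn? : ∀ y t → Dec (FreeIn y t)
freeIn? y (var x) with y ≟ x
... | yes refl = yes fvar
... | no ne = no λ { fvar → ne refl }
freeIn? y (lam a t) with freeIn? (suc y) t
... | yes f = yes (flam f)
... | no nf = no λ { (flam f) → nf f }
freeIn? y (app t u) with freeIn? y t | freeIn? y u
... | yes f | _ = yes (fappˡ f)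
... | no _ | yes g = yes (fappʳ g)
... | no nf | no ng = no λ { (fappˡ f) → nf f ; (fappʳ g) → ng g }

away? : ∀ S t → Dec (Away S t)
away? [] t = yes λ y f ()
away? (s ∷ S) t with freeIn? s t | away? S t
... | yes f | _ = no λ aw → aw s f (here refl)
... | no nf | no na = no λ aw → na (λ y f m → aw y f (there m))
... | no nf | yes a = yes λ { y f (here refl) → nf f ; y f (there m) → a y f m }

lams? : ∀ n t → Dec (Lams n t)
lams? zero t = yes tt
lams? (suc n) (var x) = no λ ()
lams? (suc n) (lam a t) = lams? n t
lams? (suc n) (app t u) = no λ ()

spine? : ∀ n y t → Dec (Spine n y t)
spine? zero y (var x) = map′ (cong var) var-inj (x ≟ y)
spine? zero y (lam _ _) = no λ ()
spine? zero y (app _ _) = no λ ()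
spine? (suc n) y (var x) = no λ ()
spine? (suc n) y (lam a t) = spine? n (suc y) t
spine? (suc n) y (app t u) = no λ ()

spineIfPos? : ∀ n m A' → Dec (0 < m → Spine n zero A')
spineIfPos? n zero A' = yes λ ()
spineIfPos? n (suc m) A' with spine? n zero A'
... | yes s = yes λ _ → s
... | no ns = no λ f → ns (f (s≤s z≤n))

splits? : ∀ (P : ℕ → ℕ → Set) → (∀ n m → Dec (P n m)) → ∀ k → Dec (Σ ℕ λ n → Σ ℕ λ m → n + m ≡ k × P n m)
splits? P d zero with d 0 0
... | yes p = yes (0 , 0 , refl , p)
... | no np = no λ { (zero , zero , e , p) → np p }
splits? P d (suc k) with d 0 (suc k) | splits? (λ n m → P (suc n) m) (λ n m → d (suc n) m) k
... | yes p | _ = yes (0 , suc k , refl , p)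
... | no _ | yes (n , m , e , p) = yes (suc n , m , cong suc e , p)
... | no np | no nq = no λ { (zero , m , refl , p) → np p ; (suc n , m , e , p) → nq (n , m , suc-injective e , p) }

CondStarAt : Tm → Tm → Seq → ℕ → ℕ → Set
CondStarAt A B S n m = Σ Tm λ C → Σ Tm λ A' → Σ Tm λ B' →
      Dev A S (suc n) (lam (lab zero) A') × Lams n A' ×
      Dev B S m B' × Lams m B' ×
      (0 < m → Spine n zero A') ×
      Away S (app (lam (lab zero) A') B') ×
      C ≡ contract A' B'

mutual
  dev? : ∀ T S k → Dec (Σ Tm (Dev T S k))
  dev? (var x) S zero = yes (var x , refl)
  dev? (var x) S (suc k) = no λ { (_ , ()) }
  dev? (lam a T) S zero with dev? T (bind S) 0
  ... | yes (A₀ , d) = yes (lam a A₀ , A₀ , d , refl)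
  ... | no nd = no λ { (_ , A₀ , d , refl) → nd (A₀ , d) }
  dev? (lam a T) S (suc k) with dev? T (under S) k
  ... | yes (A₀ , d) = yes (lam a A₀ , A₀ , d , refl)
  ... | no nd = no λ { (_ , A₀ , d , refl) → nd (A₀ , d) }
  dev? (app A B) S k with condStar? A B S k
  ... | yes (C , c) = yes (C , inj₁ c)
  dev? (app A B) S (suc k) | no nc = no λ { (C , inj₁ c) → nc (C , c) ; (C , inj₂ (() , _)) }
  dev? (app A B) S zero | no nc with dev? A S 0 | dev? B S 0
  ... | yes (A₀ , dA) | yes (B₀ , dB) = yes (app A₀ B₀ , inj₂ (refl , nc , A₀ , B₀ , dA , dB , refl))
  ... | no nA | _ = no λ { (C , inj₁ c) → nc (C , c) ; (C , inj₂ (_ , _ , A₀ , B₀ , dA , dB , _)) → nA (A₀ , dA) }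
  ... | _ | no nB = no λ { (C , inj₁ c) → nc (C , c) ; (C , inj₂ (_ , _ , A₀ , B₀ , dA , dB , _)) → nB (B₀ , dB) }

  condStar? : ∀ A B S k → Dec (Σ Tm (CondStar A B S k))
  condStar? A B S k = map′ to from (splits? (CondStarAt A B S) (condStarAt? A B S) k)
    where
    to : (Σ ℕ λ n → Σ ℕ λ m → n + m ≡ k × CondStarAt A B S n m) → Σ Tm (CondStar A B S k)
    to (n , m , e , C , A' , B' , dA , lA , dB , lB , sp , aw , eC) = C , n , m , A' , B' , dA , lA , dB , lB , e , sp , aw , eC
    from : Σ Tm (CondStar A B S k) → Σ ℕ λ n → Σ ℕ λ m → n + m ≡ k × CondStarAt A B S n m
    from (C , n , m , A' , B' , dA , lA , dB , lB , e , sp , aw , eC) = n , m , e , C , A' , B' , dA , lA , dB , lB , sp , aw , eC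

  condStarAt? : ∀ A B S n m → Dec (CondStarAt A B S n m)
  condStarAt? A B S n m with dev? A S (suc n)
  ... | no nd = no λ { (C , A' , B' , dA , _) → nd (_ , dA) }
  ... | yes (X , dX) with lam₀? X
  ... | no nl = no λ { (C , A' , B' , dA , _) → nl (A' , dev-functional A S (suc n) _ _ dX dA) }
  ... | yes (A' , refl) with lams? n A' | dev? B S m
  ... | no nl | _ = no λ { (C , A'' , B' , dA , lA , _) → nl (subst (Lams n) (sym (lam-inj (dev-functional A S (suc n) _ _ dX dA))) lA) }
  ... | yes _ | no nb = no λ { (C , A'' , B' , dA , lA , dB , _) → nb (B' , dB) }
  ... | yes lA | yes (B' , dB) with lams? m B' | spineIfPos? n m A' | away? S (app (lam (lab zero) A') B')
  ... | yes lB | yes sp | yes aw = yes (contract A' B' , A' , B' , dX , lA , dB , lB , sp , aw , refl)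
  ... | no nl | _ | _ = no λ { (C , A'' , B'' , dA , lA , dB' , lB , _) → nl (subst (Lams m) (dev-functional B S m _ _ dB' dB) lB) }
  ... | yes _ | no ns | _ = no λ { (C , A'' , B'' , dA , lA , dB' , lB , sp , _) →
          ns (subst (λ Z → 0 < m → Spine n zero Z) (sym (lam-inj (dev-functional A S (suc n) _ _ dX dA))) sp) }
  ... | yes _ | yes _ | no na = no λ { (C , A'' , B'' , dA , lA , dB' , lB , sp , aw , _) →
          na (subst₂ (λ Z W → Away S (app (lam (lab zero) Z) W)) (sym (lam-inj (dev-functional A S (suc n) _ _ dX dA))) (dev-functional B S m _ _ dB' dB) aw) }

  lam₀? : ∀ X → Dec (Σ Tm λ A' → X ≡ lam (lab zero) A')
  lam₀? (var x) = no λ { (_ , ()) }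
  lam₀? (app X Y) = no λ { (_ , ()) }
  lam₀? (lam ⋆ X) = no λ { (_ , ()) }
  lam₀? (lam (lab zero) X) = yes (X , refl)
  lam₀? (lam (lab (suc i)) X) = no λ { (_ , ()) }

-- The non-redex clause of Dev demands ¬ (⋆), so even level 0 needs (⋆) to be decided.
dev₀-total : ∀ T S → Σ Tm (Dev T S 0)
dev₀-total (var x) S = var x , refl
dev₀-total (lam a T) S with dev₀-total T (bind S)
... | A₀ , d = lam a A₀ , A₀ , d , refl
dev₀-total (app A B) S with condStar? A B S 0
... | yes (C , c) = C , inj₁ c
... | no nc with dev₀-total A S | dev₀-total B S
... | A₀ , dA | B₀ , dB = app A₀ B₀ , inj₂ (refl , nc , A₀ , B₀ , dA , dB , refl)


-- Commutation with label substitution and variable renaming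
away-redex-subL : ∀ S τ τ' a b X Y → Away S (app (lam a X) Y) → Away S (app (lam b (subL τ' X)) (subL τ Y))
away-redex-subL S τ τ' a b X Y aw y (fappˡ (flam f)) = aw y (fappˡ (flam (fv-subL⁻ τ' X f)))
away-redex-subL S τ τ' a b X Y aw y (fappʳ f) = aw y (fappʳ (fv-subL⁻ τ Y f))

away-redex-subL⁻ : ∀ S τ τ' a b X Y → Away S (app (lam b (subL τ' X)) (subL τ Y)) → Away S (app (lam a X) Y)
away-redex-subL⁻ S τ τ' a b X Y aw y (fappˡ (flam f)) = aw y (fappˡ (flam (fv-subL⁺ τ' f)))
away-redex-subL⁻ S τ τ' a b X Y aw y (fappʳ f) = aw y (fappʳ (fv-subL⁺ τ f))

extLS-lab₀⁻ : ∀ τ a → subLab (extLS τ) a ≡ lab zero → a ≡ lab zero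
extLS-lab₀⁻ τ ⋆ ()
extLS-lab₀⁻ τ (lab zero) e = refl
extLS-lab₀⁻ τ (lab (suc i)) e with τ i | e
... | ⋆ | ()
... | lab j | ()

subL-lam₀⁻ : ∀ τ C X → lam (lab zero) X ≡ subL (extLS τ) C → Σ Tm λ X₀ → C ≡ lam (lab zero) X₀ × X ≡ subL (extLS τ) X₀
subL-lam₀⁻ τ (lam a C) X e with extLS-lab₀⁻ τ a (sym (lam-lab e))
  where lam-lab : ∀ {a b P Q} → lam a P ≡ lam b Q → a ≡ b
        lam-lab refl = refl
... | refl = C , refl , lam-inj e

mutual
  dev-subL : ∀ τ T S k C → Dev T S k C → Dev (subL τ T) S k (subL τ C)
  dev-subL τ (var x) S zero C refl = refl
  dev-subL τ (lam a T) S zero C (A₀ , d , refl) = subL τ A₀ , dev-subL τ T (bind S) 0 A₀ d , refl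
  dev-subL τ (lam a T) S (suc k) C (A₀ , d , refl) = subL τ A₀ , dev-subL τ T (under S) k A₀ d , refl
  dev-subL τ (app A B) S k C (inj₁ c) = inj₁ (condStar-subL τ A B S k C c)
  dev-subL τ (app A B) S k C (inj₂ (refl , nc , A₀ , B₀ , dA , dB , refl)) =
    inj₂ (refl , (λ { (C' , c) → nc (_ , proj₂ (proj₂ (condStar-subL⁻ τ A B S 0 C' c))) }) ,
          _ , _ , dev-subL (extLS τ) A S 0 A₀ dA , dev-subL τ B S 0 B₀ dB , refl)

  condStar-subL : ∀ τ A B S k C → CondStar A B S k C → CondStar (subL (extLS τ) A) (subL τ B) S k (subL τ C)
  condStar-subL τ A B S k C (n , m , A' , B' , dA , lA , dB , lB , e , sp , aw , refl) =
    n , m , subL (extLS τ) A' , subL τ B' , dev-subL (extLS τ) A S (suc n) _ dA , lams-subL {n} (extLS τ) A' lA ,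
    dev-subL τ B S m B' dB , lams-subL {m} τ B' lB , e ,
    (λ p → spine-subL⁺ {n} {zero} (extLS τ) A' (sp p)) ,
    away-redex-subL S τ (extLS τ) (lab zero) (lab zero) A' B' aw , subL-contract τ A' B'

  condStar-subL⁻ : ∀ τ A B S k C → CondStar (subL (extLS τ) A) (subL τ B) S k C → Σ Tm λ C₀ → C ≡ subL τ C₀ × CondStar A B S k C₀
  condStar-subL⁻ τ A B S k C (n , m , X , Y , dX , lX , dY , lY , e , sp , aw , refl)
    with dev-subL⁻ (extLS τ) A S (suc n) _ dX | dev-subL⁻ τ B S m Y dY
  ... | C₀ , eC , dC | Y₀ , refl , dY₀ with subL-lam₀⁻ τ C₀ X eC
  ... | X₀ , refl , refl =
    contract X₀ Y₀ , sym (subL-contract τ X₀ Y₀) ,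
    n , m , X₀ , Y₀ , dC , lams-subL⁻ {n} (extLS τ) X₀ lX , dY₀ , lams-subL⁻ {m} τ Y₀ lY , e ,
    (λ p → spine-subL⁻ {n} {zero} (extLS τ) X₀ (sp p)) ,
    away-redex-subL⁻ S τ (extLS τ) (lab zero) (lab zero) X₀ Y₀ aw , refl

  dev-subL⁻ : ∀ τ T S k C → Dev (subL τ T) S k C → Σ Tm λ C₀ → C ≡ subL τ C₀ × Dev T S k C₀
  dev-subL⁻ τ (var x) S zero C refl = var x , refl , refl
  dev-subL⁻ τ (lam a T) S zero C (X , d , refl) with dev-subL⁻ τ T (bind S) 0 X d
  ... | A₀ , refl , d' = lam a A₀ , refl , A₀ , d' , refl
  dev-subL⁻ τ (lam a T) S (suc k) C (X , d , refl) with dev-subL⁻ τ T (under S) k X d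
  ... | A₀ , refl , d' = lam a A₀ , refl , A₀ , d' , refl
  dev-subL⁻ τ (app A B) S k C (inj₁ c) with condStar-subL⁻ τ A B S k C c
  ... | C₀ , e , c' = C₀ , e , inj₁ c'
  dev-subL⁻ τ (app A B) S k C (inj₂ (refl , nc , X , Y , dX , dY , refl))
    with dev-subL⁻ (extLS τ) A S 0 X dX | dev-subL⁻ τ B S 0 Y dY
  ... | A₀ , refl , dA | B₀ , refl , dB =
    app A₀ B₀ , refl , inj₂ (refl , (λ { (C' , c) → nc (_ , condStar-subL τ A B S 0 C' c) }) , A₀ , B₀ , dA , dB , refl)

dev-renL : ∀ ρ T S k C → Dev T S k C → Dev (renL ρ T) S k (renL ρ C)
dev-renL ρ T S k C d = subst₂ (λ P Q → Dev P S k Q) (sym (renL-as-subL ρ T)) (sym (renL-as-subL ρ C)) (dev-subL (lab ∘ ρ) T S k C d)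

dev-renL⁻ : ∀ ρ T S k C → Dev (renL ρ T) S k C → Σ Tm λ C₀ → C ≡ renL ρ C₀ × Dev T S k C₀
dev-renL⁻ ρ T S k C d with dev-subL⁻ (lab ∘ ρ) T S k C (subst (λ P → Dev P S k C) (renL-as-subL ρ T) d)
... | C₀ , e , d' = C₀ , trans e (sym (renL-as-subL ρ C₀)) , d'

renL-suc≢lam₀ : ∀ C X → ¬ (renL suc C ≡ lam (lab zero) X)
renL-suc≢lam₀ (var x) X ()
renL-suc≢lam₀ (lam ⋆ C) X ()
renL-suc≢lam₀ (lam (lab i) C) X ()
renL-suc≢lam₀ (app C C₁) X ()

suc∈under : ∀ {z} S → z ∈ S → suc z ∈ under S
suc∈under S = ∈-map⁺ suc

suc∈under⁻ : ∀ {z} S → suc z ∈ under S → z ∈ S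
suc∈under⁻ S m with ∈-map⁻ suc m
... | _ , m' , refl = m'

zero∉under : ∀ S → ¬ (0 ∈ under S)
zero∉under S m with ∈-map⁻ suc m
... | _ , _ , ()

Transports : (ℕ → ℕ) → Tm → Seq → Seq → Set
Transports ρ T S S' = ∀ y → FreeIn y T → (y ∈ S → ρ y ∈ S') × (ρ y ∈ S' → y ∈ S)

transports-bind : ∀ ρ a T S S' → Transports ρ (lam a T) S S' → Transports (extR ρ) T (bind S) (bind S')
transports-bind ρ a T S S' tr zero f = (λ _ → here refl) , (λ _ → here refl)
transports-bind ρ a T S S' tr (suc y) f =
  (λ { (here ()) ; (there m) → there (suc∈under S' (proj₁ (tr y (flam f)) (suc∈under⁻ S m))) }) ,
  (λ { (here ()) ; (there m) → there (suc∈under S (proj₂ (tr y (flam f)) (suc∈under⁻ S' m))) })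

transports-under : ∀ ρ a T S S' → Transports ρ (lam a T) S S' → Transports (extR ρ) T (under S) (under S')
transports-under ρ a T S S' tr zero f = (λ m → ⊥-elim (zero∉under S m)) , (λ m → ⊥-elim (zero∉under S' m))
transports-under ρ a T S S' tr (suc y) f =
  (λ m → suc∈under S' (proj₁ (tr y (flam f)) (suc∈under⁻ S m))) ,
  (λ m → suc∈under S (proj₂ (tr y (flam f)) (suc∈under⁻ S' m)))

transports-appˡ : ∀ ρ A B S S' → Transports ρ (app A B) S S' → Transports ρ A S S'
transports-appˡ ρ A B S S' tr y f = tr y (fappˡ f)

transports-appʳ : ∀ ρ A B S S' → Transports ρ (app A B) S S' → Transports ρ B S S'
transports-appʳ ρ A B S S' tr y f = tr y (fappʳ f)

renV-contract : ∀ ρ X Y → renV ρ (contract X Y) ≡ contract (renV (extR ρ) X) (renV ρ Y)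
renV-contract ρ X Y = trans (renV-as-sub ρ (contract X Y)) (trans (sub-contract (var ∘ ρ) X Y)
  (cong₂ contract (trans (sub-ext (λ { zero → refl ; (suc i) → refl }) X) (sym (renV-as-sub (extR ρ) X)))
                  (sym (renV-as-sub ρ Y))))

renV-lam₀⁻ : ∀ ρ C X → lam (lab zero) X ≡ renV ρ C → Σ Tm λ X₀ → C ≡ lam (lab zero) X₀ × X ≡ renV (extR ρ) X₀
renV-lam₀⁻ ρ (lam .(lab zero) C) X refl = C , refl , refl

fv-redex : ∀ A B S n m A' B' y → Dev A S (suc n) (lam (lab zero) A') → Dev B S m B' →
           FreeIn y (app (lam (lab zero) A') B') → FreeIn y (app A B)
fv-redex A B S n m A' B' y dA dB (fappˡ f) = fappˡ (dev-fv A S (suc n) _ dA f)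
fv-redex A B S n m A' B' y dA dB (fappʳ f) = fappʳ (dev-fv B S m _ dB f)

mutual
  dev-renV : ∀ ρ T S S' k C → Transports ρ T S S' → Dev T S k C → Dev (renV ρ T) S' k (renV ρ C)
  dev-renV ρ (var x) S S' zero C tr refl = refl
  dev-renV ρ (lam a T) S S' zero C tr (A₀ , d , refl) =
    _ , dev-renV (extR ρ) T (bind S) (bind S') 0 A₀ (transports-bind ρ a T S S' tr) d , refl
  dev-renV ρ (lam a T) S S' (suc k) C tr (A₀ , d , refl) =
    _ , dev-renV (extR ρ) T (under S) (under S') k A₀ (transports-under ρ a T S S' tr) d , refl
  dev-renV ρ (app A B) S S' k C tr (inj₁ c) = inj₁ (condStar-renV ρ A B S S' k C tr c)
  dev-renV ρ (app A B) S S' k C tr (inj₂ (refl , nc , A₀ , B₀ , dA , dB , refl)) =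
    inj₂ (refl , (λ { (C' , c) → nc (_ , proj₂ (proj₂ (condStar-renV⁻ ρ A B S S' 0 C' tr c))) }) ,
          _ , _ , dev-renV ρ A S S' 0 A₀ (transports-appˡ ρ A B S S' tr) dA , dev-renV ρ B S S' 0 B₀ (transports-appʳ ρ A B S S' tr) dB , refl)

  condStar-renV : ∀ ρ A B S S' k C → Transports ρ (app A B) S S' → CondStar A B S k C → CondStar (renV ρ A) (renV ρ B) S' k (renV ρ C)
  condStar-renV ρ A B S S' k C tr (n , m , A' , B' , dA , lA , dB , lB , e , sp , aw , refl) =
    n , m , renV (extR ρ) A' , renV ρ B' ,
    dev-renV ρ A S S' (suc n) _ (transports-appˡ ρ A B S S' tr) dA , lams-renV⁺ {n} (extR ρ) A' lA ,
    dev-renV ρ B S S' m B' (transports-appʳ ρ A B S S' tr) dB , lams-renV⁺ {m} ρ B' lB , e ,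
    (λ p → spine-renV⁺ {n} {zero} (extR ρ) A' (sp p)) ,
    aw' , renV-contract ρ A' B'
    where
    aw' : Away S' (renV ρ (app (lam (lab zero) A') B'))
    aw' y f ym with fv-renV⁻ ρ (app (lam (lab zero) A') B') f
    ... | z , g , refl = aw z g (proj₂ (tr z (fv-redex A B S n m A' B' z dA dB g)) ym)

  condStar-renV⁻ : ∀ ρ A B S S' k C → Transports ρ (app A B) S S' → CondStar (renV ρ A) (renV ρ B) S' k C →
              Σ Tm λ C₀ → C ≡ renV ρ C₀ × CondStar A B S k C₀
  condStar-renV⁻ ρ A B S S' k C tr (n , m , X , Y , dX , lX , dY , lY , e , sp , aw , refl)
    with dev-renV⁻ ρ A S S' (suc n) _ (transports-appˡ ρ A B S S' tr) dX | dev-renV⁻ ρ B S S' m Y (transports-appʳ ρ A B S S' tr) dY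
  ... | C₀ , eC , dC | Y₀ , refl , dY₀ with renV-lam₀⁻ ρ C₀ X eC
  ... | X₀ , refl , refl =
    contract X₀ Y₀ , sym (renV-contract ρ X₀ Y₀) ,
    n , m , X₀ , Y₀ , dC , lams-renV⁻ {n} (extR ρ) X₀ lX , dY₀ , lams-renV⁻ {m} ρ Y₀ lY , e ,
    (λ p → sp0 (spine-renV⁻ {n} {zero} (extR ρ) X₀ (sp p))) , aw₀ , refl
    where
    sp0 : (Σ ℕ λ w → Spine n w X₀ × extR ρ w ≡ zero) → Spine n zero X₀
    sp0 (zero , s , _) = s
    sp0 (suc w , s , ())
    aw₀ : Away S (app (lam (lab zero) X₀) Y₀)
    aw₀ z g zm = aw (ρ z) (fv-renV⁺ ρ g) (proj₁ (tr z (fv-redex A B S n m X₀ Y₀ z dC dY₀ g)) zm)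

  dev-renV⁻ : ∀ ρ T S S' k C → Transports ρ T S S' → Dev (renV ρ T) S' k C → Σ Tm λ C₀ → C ≡ renV ρ C₀ × Dev T S k C₀
  dev-renV⁻ ρ (var x) S S' zero C tr refl = var x , refl , refl
  dev-renV⁻ ρ (lam a T) S S' zero C tr (X , d , refl) with dev-renV⁻ (extR ρ) T (bind S) (bind S') 0 X (transports-bind ρ a T S S' tr) d
  ... | A₀ , refl , d' = lam a A₀ , refl , A₀ , d' , refl
  dev-renV⁻ ρ (lam a T) S S' (suc k) C tr (X , d , refl) with dev-renV⁻ (extR ρ) T (under S) (under S') k X (transports-under ρ a T S S' tr) d
  ... | A₀ , refl , d' = lam a A₀ , refl , A₀ , d' , refl
  dev-renV⁻ ρ (app A B) S S' k C tr (inj₁ c) with condStar-renV⁻ ρ A B S S' k C tr c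
  ... | C₀ , e , c' = C₀ , e , inj₁ c'
  dev-renV⁻ ρ (app A B) S S' k C tr (inj₂ (refl , nc , X , Y , dX , dY , refl))
    with dev-renV⁻ ρ A S S' 0 X (transports-appˡ ρ A B S S' tr) dX | dev-renV⁻ ρ B S S' 0 Y (transports-appʳ ρ A B S S' tr) dY
  ... | A₀ , refl , dA | B₀ , refl , dB =
    app A₀ B₀ , refl , inj₂ (refl , (λ { (C' , c) → nc (_ , condStar-renV ρ A B S S' 0 C' tr c) }) , A₀ , B₀ , dA , dB , refl)


-- The substitution lemma
≡ᵇ-refl : ∀ x → (x ≡ᵇ x) ≡ true
≡ᵇ-refl zero = refl
≡ᵇ-refl (suc x) = ≡ᵇ-refl x

≡ᵇ-false : ∀ y x → y ≢ x → (y ≡ᵇ x) ≡ false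
≡ᵇ-false zero zero ne = ⊥-elim (ne refl)
≡ᵇ-false zero (suc x) ne = refl
≡ᵇ-false (suc y) zero ne = refl
≡ᵇ-false (suc y) (suc x) ne = ≡ᵇ-false y x (ne ∘ cong suc)

subRen-self : ∀ x B ρ → subRen x B ρ x ≡ B
subRen-self x B ρ rewrite ≡ᵇ-refl x = refl

subRen-other : ∀ x B ρ y → y ≢ x → subRen x B ρ y ≡ var (ρ y)
subRen-other x B ρ y ne rewrite ≡ᵇ-false y x ne = refl

extS-subRen : ∀ x B ρ → extS (subRen x B ρ) ≗ subRen (suc x) (renV suc B) (extR ρ)
extS-subRen x B ρ zero = refl
extS-subRen x B ρ (suc i) with i ≡ᵇ x
... | true = refl
... | false = refl

sub-extS-subRen : ∀ x B ρ t → sub (extS (subRen x B ρ)) t ≡ sub (subRen (suc x) (renV suc B) (extR ρ)) t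
sub-extS-subRen x B ρ t = sub-ext (extS-subRen x B ρ) t

renL-subRen : ∀ x B ρ → (λ i → renL suc (subRen x B ρ i)) ≗ subRen x (renL suc B) ρ
renL-subRen x B ρ i with i ≡ᵇ x
... | true = refl
... | false = refl

sub-renL-subRen : ∀ x B ρ t → sub (λ i → renL suc (subRen x B ρ i)) t ≡ sub (subRen x (renL suc B) ρ) t
sub-renL-subRen x B ρ t = sub-ext (renL-subRen x B ρ) t

-- The hypothesis x ∉ S ∩ FV(A), generalised to a renaming ρ that carries S to S' on the other free variables.
TransportsExcept : ℕ → (ℕ → ℕ) → Tm → Seq → Seq → Set
TransportsExcept x ρ T S S' = (FreeIn x T → ¬ x ∈ S) ×
  (∀ y → y ≢ x → FreeIn y T → (y ∈ S → ρ y ∈ S') × (ρ y ∈ S' → y ∈ S))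

transportsExcept-appˡ : ∀ x ρ A B S S' → TransportsExcept x ρ (app A B) S S' → TransportsExcept x ρ A S S'
transportsExcept-appˡ x ρ A B S S' (x∉S , h2) = (λ f → x∉S (fappˡ f)) , (λ y ne f → h2 y ne (fappˡ f))

transportsExcept-appʳ : ∀ x ρ A B S S' → TransportsExcept x ρ (app A B) S S' → TransportsExcept x ρ B S S'
transportsExcept-appʳ x ρ A B S S' (x∉S , h2) = (λ f → x∉S (fappʳ f)) , (λ y ne f → h2 y ne (fappʳ f))

transportsExcept-bind : ∀ x ρ a T S S' → TransportsExcept x ρ (lam a T) S S' → TransportsExcept (suc x) (extR ρ) T (bind S) (bind S')
transportsExcept-bind x ρ a T S S' (x∉S , h2) =
  (λ { f (here ()) ; f (there m) → x∉S (flam f) (suc∈under⁻ S m) }) ,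
  λ { zero ne f → (λ _ → here refl) , (λ _ → here refl)
    ; (suc y) ne f → (λ { (here ()) ; (there m) → there (suc∈under S' (proj₁ (h2 y (ne ∘ cong suc) (flam f)) (suc∈under⁻ S m))) }) ,
                     (λ { (here ()) ; (there m) → there (suc∈under S (proj₂ (h2 y (ne ∘ cong suc) (flam f)) (suc∈under⁻ S' m))) }) }

transportsExcept-under : ∀ x ρ a T S S' → TransportsExcept x ρ (lam a T) S S' → TransportsExcept (suc x) (extR ρ) T (under S) (under S')
transportsExcept-under x ρ a T S S' (x∉S , h2) =
  (λ f m → x∉S (flam f) (suc∈under⁻ S m)) ,
  λ { zero ne f → (λ m → ⊥-elim (zero∉under S m)) , (λ m → ⊥-elim (zero∉under S' m))
    ; (suc y) ne f → (λ m → suc∈under S' (proj₁ (h2 y (ne ∘ cong suc) (flam f)) (suc∈under⁻ S m))) ,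
                     (λ m → suc∈under S (proj₂ (h2 y (ne ∘ cong suc) (flam f)) (suc∈under⁻ S' m))) }

transports-suc-bind : ∀ B S' → Transports suc B S' (bind S')
transports-suc-bind B S' y f = (λ m → there (suc∈under S' m)) , (λ { (here ()) ; (there m) → suc∈under⁻ S' m })

transports-suc-under : ∀ B S' → Transports suc B S' (under S')
transports-suc-under B S' y f = (λ m → suc∈under S' m) , (λ m → suc∈under⁻ S' m)

away-bind-renV : ∀ S' B → Away S' B → Away (bind S') (renV suc B)
away-bind-renV S' B aw y f m with fv-renV⁻ suc B f
... | z , g , refl with m
... | here ()
... | there m' = aw z g (suc∈under⁻ S' m')

away-under-renV : ∀ S' B → Away S' B → Away (under S') (renV suc B)
away-under-renV S' B aw y f m with fv-renV⁻ suc B f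
... | z , g , refl = aw z g (suc∈under⁻ S' m)

away-renL : ∀ S' B → Away S' B → Away S' (renL suc B)
away-renL S' B aw y f = aw y (fv-renL⁻ suc B f)

SubstWithin : ℕ → (ℕ → ℕ) → Tm → (ℕ → Tm) → Set
SubstWithin x ρ B σ = (∀ z → z ≢ x → σ z ≡ var (ρ z)) × (∀ y → FreeIn y (σ x) → FreeIn y B)

dev-within : ∀ x ρ B S q B₀ → Dev B S q B₀ → SubstWithin x ρ B (subRen x B₀ ρ)
dev-within x ρ B S q B₀ d =
  (λ z ne → subRen-other x B₀ ρ z ne) , (λ y f → dev-fv B S q B₀ d (subst (FreeIn y) (subRen-self x B₀ ρ) f))

dev-within-renL : ∀ x ρ B S q B₀ → Dev B S q B₀ → SubstWithin x ρ B (subRen x (renL suc B₀) ρ)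
dev-within-renL x ρ B S q B₀ d =
  (λ z ne → subRen-other x _ ρ z ne) ,
  (λ y f → dev-fv B S q B₀ d (fv-renL⁻ suc B₀ (subst (FreeIn y) (subRen-self x _ ρ) f)))

fv-var : ∀ {y w} → FreeIn y (var w) → y ≡ w
fv-var fvar = refl

away-sub⁺ : ∀ x ρ T S S' B σ R → TransportsExcept x ρ T S S' → Away S' B → SubstWithin x ρ B σ →
  (∀ z → FreeIn z R → FreeIn z T) → (∀ z → FreeIn z R → ¬ z ∈ S) → ∀ y → FreeIn y (sub σ R) → ¬ y ∈ S'
away-sub⁺ x ρ T S S' B σ R hyp awB (g1 , g2) inc aw y f ym with fv-sub⁻ σ R f
... | z , fz , h with z ≟ x
... | yes refl = awB y (g2 y h) ym
... | no ne with fv-var (subst (FreeIn y) (g1 z ne) h)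
... | refl = aw z fz (proj₂ (proj₂ hyp z ne (inc z fz)) ym)

away-sub⁻ : ∀ x ρ T S S' B σ R → TransportsExcept x ρ T S S' → SubstWithin x ρ B σ →
  (∀ z → FreeIn z R → FreeIn z T) → (∀ y → FreeIn y (sub σ R) → ¬ y ∈ S') → ∀ z → FreeIn z R → ¬ z ∈ S
away-sub⁻ x ρ T S S' B σ R hyp (g1 , g2) inc aw z f zm with z ≟ x
... | yes refl = proj₁ hyp (inc z f) zm
... | no ne = aw (ρ z) (fv-sub⁺ σ f (subst (FreeIn (ρ z)) (sym (g1 z ne)) fvar)) (proj₁ (proj₂ hyp z ne (inc z f)) zm)

away-redex-sub⁺ : ∀ x ρ T S S' B σ₁ σ₂ R₁ R₂ → TransportsExcept x ρ T S S' → Away S' B → SubstWithin x ρ B σ₁ → SubstWithin x ρ B σ₂ →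
  (∀ z → FreeIn z (app R₁ R₂) → FreeIn z T) → Away S (app R₁ R₂) → Away S' (app (sub σ₁ R₁) (sub σ₂ R₂))
away-redex-sub⁺ x ρ T S S' B σ₁ σ₂ R₁ R₂ hyp awB g₁ g₂ inc aw y (fappˡ f) =
  away-sub⁺ x ρ T S S' B σ₁ R₁ hyp awB g₁ (λ z h → inc z (fappˡ h)) (λ z h → aw z (fappˡ h)) y f
away-redex-sub⁺ x ρ T S S' B σ₁ σ₂ R₁ R₂ hyp awB g₁ g₂ inc aw y (fappʳ f) =
  away-sub⁺ x ρ T S S' B σ₂ R₂ hyp awB g₂ (λ z h → inc z (fappʳ h)) (λ z h → aw z (fappʳ h)) y f

away-redex-sub⁻ : ∀ x ρ T S S' B σ₁ σ₂ R₁ R₂ → TransportsExcept x ρ T S S' → SubstWithin x ρ B σ₁ → SubstWithin x ρ B σ₂ →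
  (∀ z → FreeIn z (app R₁ R₂) → FreeIn z T) → Away S' (app (sub σ₁ R₁) (sub σ₂ R₂)) → Away S (app R₁ R₂)
away-redex-sub⁻ x ρ T S S' B σ₁ σ₂ R₁ R₂ hyp g₁ g₂ inc aw z (fappˡ f) =
  away-sub⁻ x ρ T S S' B σ₁ R₁ hyp g₁ (λ z h → inc z (fappˡ h)) (λ y h → aw y (fappˡ h)) z f
away-redex-sub⁻ x ρ T S S' B σ₁ σ₂ R₁ R₂ hyp g₁ g₂ inc aw z (fappʳ f) =
  away-sub⁻ x ρ T S S' B σ₂ R₂ hyp g₂ (λ z h → inc z (fappʳ h)) (λ y h → aw y (fappʳ h)) z f

spine₀-sub-extS : ∀ {j} σ W → Spine j zero W → Spine j zero (sub (extS σ) W)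
spine₀-sub-extS {j} σ W s = subst (λ k → Spine k zero (sub (extS σ) W)) (+-identityʳ j)
  (spine-sub⁺ {j} {zero} {zero} {zero} (extS σ) W s refl)

spine₀-sub-extS⁻ : ∀ {j} σ W → Spine j zero (sub (extS σ) W) → Spine j zero W
spine₀-sub-extS⁻ {j} σ W s with spine-sub⁻ {j} {zero} (extS σ) W s
... | p , zero , zero , e , sp , sq = subst (λ k → Spine k zero W) (trans (sym (+-identityʳ p)) e) sp
... | p , suc q , zero , e , sp , ()
... | p , q , suc v , e , sp , sq with spine-renV⁻ {q} {zero} suc (σ v) sq
... | w , _ , ()

spine-fv : ∀ {n y z} X → Spine n y X → FreeIn z X → z ≡ y
spine-fv {zero} (var x) refl fvar = refl
spine-fv {suc n} (lam a X) s (flam f) = suc-injective (spine-fv {n} X s f)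

sub-extS-spine₀ : ∀ {j} σ σ' W → Spine j zero W → sub (extS σ) W ≡ sub (extS σ') W
sub-extS-spine₀ {j} σ σ' W s = sub-agree W (λ z f → helper z (spine-fv {j} W s f))
  where helper : ∀ z → z ≡ zero → extS σ z ≡ extS σ' z
        helper .zero refl = refl

¬fv₀-sub-extS-spine : ∀ {j v} σ W → Spine j (suc v) W → ¬ FreeIn zero (sub (extS σ) W)
¬fv₀-sub-extS-spine {j} {v} σ W s f with fv-sub⁻ (extS σ) W f
... | z , g , h with spine-fv {j} W s g
... | refl with fv-renV⁻ suc (σ v) h
... | _ , _ , ()

lams-suc⇒lam : ∀ {p} T → Lams (suc p) T → Σ Lab λ a → Σ Tm λ W → T ≡ lam a W
lams-suc⇒lam (lam a W) l = a , W , refl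

lam≢var : ∀ {a A x} → ¬ (lam a A ≡ var x)
lam≢var ()
app≢var : ∀ {A B x} → ¬ (app A B ≡ var x)
app≢var ()

SubstSplit : ℕ → Tm → (ℕ → ℕ) → Tm → Seq → Seq → ℕ → Tm → Set
SubstSplit x B ρ T S S' k C = Σ ℕ λ n → Σ ℕ λ m → Σ Tm λ A₀ → Σ Tm λ B₀ →
  k ≡ n + m × Dev T S n A₀ × Dev B S' m B₀ × (0 < m → Spine n x A₀) × C ≡ sub (subRen x B₀ ρ) A₀

dev-subRen⁻-other : ∀ x B ρ S S' y k C → y ≢ x → Dev (var (ρ y)) S' k C → SubstSplit x B ρ (var y) S S' k C
dev-subRen⁻-other x B ρ S S' y zero C ne refl =
  0 , 0 , var y , proj₁ (dev₀-total B S') , refl , refl , proj₂ (dev₀-total B S') , (λ ()) , sym (subRen-other x _ ρ y ne)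
dev-subRen⁻-other x B ρ S S' y (suc k) C ne ()

sub-extS-subRen-level : ∀ x ρ B S' p' W B₁' B₂ s → Dev B S' 0 B₁' → Dev B S' s B₂ → (0 < s → Spine p' zero W) →
  sub (extS (λ i → renL suc (subRen x B₂ ρ i))) W ≡ sub (extS (subRen x (renL suc B₁') ρ)) W
sub-extS-subRen-level x ρ B S' p' W B₁' B₂ zero d1 d2 sp with dev-functional B S' 0 B₁' B₂ d1 d2
... | refl = sub-ext (extS-ext (renL-subRen x B₁' ρ)) W
sub-extS-subRen-level x ρ B S' p' W B₁' B₂ (suc s) d1 d2 sp = sub-extS-spine₀ {p'} _ _ W (sp (s≤s z≤n))

dev-subRen⁻-redex : ∀ A₁ A₂ x B ρ S S' k n' m' X Y p q A₁₀ B₁' r s A₂₀ B₂ →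
  TransportsExcept x ρ (app A₁ A₂) S S' →
  (0 < m' → Spine n' zero X) → Away S' (app (lam (lab zero) X) Y) → n' + m' ≡ k →
  suc n' ≡ p + q → Dev A₁ S p A₁₀ → Dev B S' q B₁' → (0 < q → Spine p x A₁₀) →
  lam (lab zero) X ≡ sub (subRen x (renL suc B₁') ρ) A₁₀ →
  m' ≡ r + s → Dev A₂ S r A₂₀ → Dev B S' s B₂ → (0 < s → Spine r x A₂₀) → Y ≡ sub (subRen x B₂ ρ) A₂₀ →
  SubstSplit x B ρ (app A₁ A₂) S S' k (contract X Y)
dev-subRen⁻-redex A₁ A₂ x B ρ S S' k n' m' X Y zero q A₁₀ B₁' r s A₂₀ B₂ hyp sp' aw' e' e₁ dA₁₀ dB₁' spq eX e₂ dA₂₀ dB₂ sps eY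
  with spq (subst (0 <_) e₁ (s≤s z≤n))
... | refl = ⊥-elim (renL-suc≢lam₀ B₁' X (sym (trans eX (subRen-self x (renL suc B₁') ρ))))
dev-subRen⁻-redex A₁ A₂ x B ρ S S' k n' m' X Y (suc p') q A₁₀ B₁' r s A₂₀ B₂ hyp sp' aw' e' e₁ dA₁₀ dB₁' spq eX e₂ dA₂₀ dB₂ sps eY
  with lams-suc⇒lam {p'} A₁₀ (dev-lams A₁ S (suc p') A₁₀ dA₁₀)
... | a , W , refl with eX
... | refl with q
... | zero with trans (suc-injective e₁) (+-identityʳ p')
... | refl =
  (p' + r) , s , contract W A₂₀ , B₂ , k≡ , dev-redex , dB₂ , result-spine , result-≡
  where
  σ₁ : ℕ → Tm
  σ₁ = subRen x (renL suc B₁') ρ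
  σ₂ : ℕ → Tm
  σ₂ = subRen x B₂ ρ
  k≡ : k ≡ (p' + r) + s
  k≡ = trans (sym e') (trans (cong (p' +_) e₂) (sym (+-assoc p' r s)))
  redex-away : Away S (app (lam (lab zero) W) A₂₀)
  redex-away = away-redex-sub⁻ x ρ (app A₁ A₂) S S' B σ₁ σ₂ (lam (lab zero) W) A₂₀ hyp
          (dev-within-renL x ρ B S' 0 B₁' dB₁') (dev-within x ρ B S' s B₂ dB₂)
          (λ z f → fv-redex A₁ A₂ S p' r W A₂₀ z dA₁₀ dA₂₀ f)
          (subst (λ Z → Away S' (app (lam (lab zero) (sub (extS σ₁) W)) Z)) eY aw')
  body-spine : 0 < r → Spine p' zero W
  body-spine pr = spine₀-sub-extS⁻ {p'} σ₁ W (sp' (m≡n+o∧0<n⇒0<m e₂ pr))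
  dev-redex : Dev (app A₁ A₂) S (p' + r) (contract W A₂₀)
  dev-redex = inj₁ (p' , r , W , A₂₀ , dA₁₀ , dev-lams A₁ S (suc p') _ dA₁₀ , dA₂₀ , dev-lams A₂ S r A₂₀ dA₂₀ , refl , body-spine , redex-away , refl)
  result-spine : 0 < s → Spine (p' + r) x (contract W A₂₀)
  result-spine ps = spine-contract-arg {p'} {r} {x} W A₂₀ (spine₀-sub-extS⁻ {p'} σ₁ W (sp' (m≡n+o∧0<o⇒0<m e₂ ps))) (sps ps)
  result-≡ : contract (sub (extS σ₁) W) Y ≡ sub σ₂ (contract W A₂₀)
  result-≡ = sym (trans (sub-contract σ₂ W A₂₀) (cong₂ contract
          (sub-extS-subRen-level x ρ B S' p' W B₁' B₂ s dB₁' dB₂ (λ ps → spine₀-sub-extS⁻ {p'} σ₁ W (sp' (m≡n+o∧0<o⇒0<m e₂ ps)))) (sym eY)))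
dev-subRen⁻-redex A₁ A₂ x B ρ S S' k n' m' X Y (suc p') q A₁₀ B₁' r s A₂₀ B₂ hyp sp' aw' e' e₁ dA₁₀ dB₁' spq eX e₂ dA₂₀ dB₂ sps eY
  | a , W , refl | refl | suc q' with m'
... | suc m'' with spine-unique {n'} {p'} W (spine₀-sub-extS⁻ {n'} (subRen x (renL suc B₁') ρ) W (sp' (s≤s z≤n))) (spq (s≤s z≤n))
... | _ , ()
dev-subRen⁻-redex A₁ A₂ x B ρ S S' k n' m' X Y (suc p') q A₁₀ B₁' zero zero A₂₀ B₂ hyp sp' aw' e' e₁ dA₁₀ dB₁' spq eX e₂ dA₂₀ dB₂ sps eY
  | a , W , refl | refl | suc q' | zero =
  p' , suc q' , contract W A₂₀ , B₁' , k≡ , dev-redex , dB₁' , (λ _ → spine-contract-body {p'} {x} W A₂₀ (spq (s≤s z≤n))) , result-≡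
  where
  σ₁ : ℕ → Tm
  σ₁ = subRen x (renL suc B₁') ρ
  σ₁' : ℕ → Tm
  σ₁' = subRen x B₁' ρ
  σ₂ : ℕ → Tm
  σ₂ = subRen x B₂ ρ
  k≡ : k ≡ p' + suc q'
  k≡ = trans (sym e') (trans (+-identityʳ n') (suc-injective e₁))
  redex-away : Away S (app (lam (lab zero) W) A₂₀)
  redex-away = away-redex-sub⁻ x ρ (app A₁ A₂) S S' B σ₁ σ₂ (lam (lab zero) W) A₂₀ hyp
          (dev-within-renL x ρ B S' (suc q') B₁' dB₁') (dev-within x ρ B S' 0 B₂ dB₂)
          (λ z f → fv-redex A₁ A₂ S p' 0 W A₂₀ z dA₁₀ dA₂₀ f)
          (subst (λ Z → Away S' (app (lam (lab zero) (sub (extS σ₁) W)) Z)) eY aw')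
  dev-redex : Dev (app A₁ A₂) S p' (contract W A₂₀)
  dev-redex = inj₁ (p' , 0 , W , A₂₀ , dA₁₀ , dev-lams A₁ S (suc p') _ dA₁₀ , dA₂₀ , tt , +-identityʳ p' , (λ ()) , redex-away , refl)
  result-≡ : contract (sub (extS σ₁) W) Y ≡ sub σ₁' (contract W A₂₀)
  result-≡ = sym (trans (sub-contract σ₁' W A₂₀) (trans
          (cong (λ Z → contract Z (sub σ₁' A₂₀)) (sub-ext (extS-ext (renL-subRen x B₁' ρ)) W))
          (contract-irrel _ _ _ (¬fv₀-sub-extS-spine {p'} {x} σ₁ W (spq (s≤s z≤n))))))

dev-level-≡ : ∀ T S C {j j'} → j ≡ j' → Dev T S j C → Dev T S j' C
dev-level-≡ T S C refl d = d

mutual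
  dev-subRen : ∀ T x B ρ S S' n m A₀ B₀ → TransportsExcept x ρ T S S' → Away S' B → Dev T S n A₀ → Dev B S' m B₀ →
    (0 < m → Spine n x A₀) → Dev (sub (subRen x B ρ) T) S' (n + m) (sub (subRen x B₀ ρ) A₀)
  dev-subRen (var y) x B ρ S S' zero m A₀ B₀ hyp awB refl dB sp with y ≟ x
  ... | yes refl = subst₂ (λ P Q → Dev P S' m Q) (sym (subRen-self x B ρ)) (sym (subRen-self x B₀ ρ)) dB
  dev-subRen (var y) x B ρ S S' zero zero A₀ B₀ hyp awB refl dB sp | no ne =
    subst₂ (λ P Q → Dev P S' 0 Q) (sym (subRen-other x B ρ y ne)) (sym (subRen-other x B₀ ρ y ne)) refl
  dev-subRen (var y) x B ρ S S' zero (suc m) A₀ B₀ hyp awB refl dB sp | no ne = ⊥-elim (ne (var-inj (sp (s≤s z≤n))))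
  dev-subRen (lam a T) x B ρ S S' zero zero A₀ B₀ hyp awB (A₁ , d₁ , refl) dB sp =
    _ , subst₂ (λ P Q → Dev P (bind S') 0 Q) (sym (sub-extS-subRen x B ρ T)) (sym (sub-extS-subRen x B₀ ρ A₁))
          (dev-subRen T (suc x) (renV suc B) (extR ρ) (bind S) (bind S') 0 0 A₁ (renV suc B₀)
            (transportsExcept-bind x ρ a T S S' hyp) (away-bind-renV S' B awB) d₁
            (dev-renV suc B S' (bind S') 0 B₀ (transports-suc-bind B S') dB) (λ ())) , refl
  dev-subRen (lam a T) x B ρ S S' zero (suc m) A₀ B₀ hyp awB (A₁ , d₁ , refl) dB sp = ⊥-elim (lam≢var (sp (s≤s z≤n)))
  dev-subRen (lam a T) x B ρ S S' (suc n) m A₀ B₀ hyp awB (A₁ , d₁ , refl) dB sp =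
    _ , subst₂ (λ P Q → Dev P (under S') (n + m) Q) (sym (sub-extS-subRen x B ρ T)) (sym (sub-extS-subRen x B₀ ρ A₁))
          (dev-subRen T (suc x) (renV suc B) (extR ρ) (under S) (under S') n m A₁ (renV suc B₀)
            (transportsExcept-under x ρ a T S S' hyp) (away-under-renV S' B awB) d₁
            (dev-renV suc B S' (under S') m B₀ (transports-suc-under B S') dB) sp) , refl
  dev-subRen (app A₁ A₂) x B ρ S S' n m A₀ B₀ hyp awB dev-redex dB sp =
    subst (λ P → Dev (app P (sub (subRen x B ρ) A₂)) S' (n + m) (sub (subRen x B₀ ρ) A₀)) (sym (sub-renL-subRen x B ρ A₁))
      (dev-subRen-app A₁ A₂ x B ρ S S' n m A₀ B₀ hyp awB dev-redex dB sp)

  dev-subRen-app : ∀ A₁ A₂ x B ρ S S' n m A₀ B₀ → TransportsExcept x ρ (app A₁ A₂) S S' → Away S' B → Dev (app A₁ A₂) S n A₀ →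
    Dev B S' m B₀ → (0 < m → Spine n x A₀) →
    Dev (app (sub (subRen x (renL suc B) ρ) A₁) (sub (subRen x B ρ) A₂)) S' (n + m) (sub (subRen x B₀ ρ) A₀)
  dev-subRen-app A₁ A₂ x B ρ S S' n (suc m) A₀ B₀ hyp awB (inj₂ (refl , _ , _ , _ , _ , _ , refl)) dB sp =
    ⊥-elim (app≢var (sp (s≤s z≤n)))
  dev-subRen-app A₁ A₂ x B ρ S S' n zero A₀ B₀ hyp awB (inj₂ (refl , nc , A₁₀ , A₂₀ , d₁ , d₂ , refl)) dB sp =
    inj₂ (refl , ¬condStar-subRen A₁ A₂ x B ρ S S' hyp awB nc , _ , _ ,
      dev-subRen A₁ x (renL suc B) ρ S S' 0 0 A₁₀ (renL suc B₀) (transportsExcept-appˡ x ρ A₁ A₂ S S' hyp) (away-renL S' B awB) d₁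
        (dev-renL suc B S' 0 B₀ dB) (λ ()) ,
      dev-subRen A₂ x B ρ S S' 0 0 A₂₀ B₀ (transportsExcept-appʳ x ρ A₁ A₂ S S' hyp) awB d₂ dB (λ ()) ,
      cong₂ app (sub-renL-subRen x B₀ ρ A₁₀) refl)
  dev-subRen-app A₁ A₂ x B ρ S S' n zero A₀ B₀ hyp awB (inj₁ (n₁ , m₁ , A' , A₂' , dA , lA , dA₂ , lA₂ , refl , sp₁ , aw , refl)) dB sp =
    inj₁ (condStar-subRen A₁ A₂ x B ρ S S' n₁ m₁ A' A₂' B₀ hyp awB dA lA dA₂ lA₂ sp₁ aw dB)
  dev-subRen-app A₁ A₂ x B ρ S S' n (suc m) A₀ B₀ hyp awB (inj₁ (n₁ , m₁ , A' , A₂' , dA , lA , dA₂ , lA₂ , refl , sp₁ , aw , refl)) dB sp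
    with spine-contract⁻ {n₁} {m₁} {x} A' A₂' lA sp₁ (sp (s≤s z≤n))
  ... | inj₁ (s₀ , sx) = inj₁ (condStar-subRen-arg A₁ A₂ x B ρ S S' n₁ m₁ m A' A₂' B₀ hyp awB dA lA dA₂ s₀ sx aw dB)
  ... | inj₂ (refl , sx) = inj₁ (condStar-subRen-body A₁ A₂ x B ρ S S' n₁ m A' A₂' B₀ hyp awB dA dA₂ sx aw dB)

  condStar-subRen : ∀ A₁ A₂ x B ρ S S' n₁ m₁ A' A₂' B₀ → TransportsExcept x ρ (app A₁ A₂) S S' → Away S' B →
    Dev A₁ S (suc n₁) (lam (lab zero) A') → Lams n₁ A' → Dev A₂ S m₁ A₂' → Lams m₁ A₂' → (0 < m₁ → Spine n₁ zero A') →
    Away S (app (lam (lab zero) A') A₂') → Dev B S' 0 B₀ →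
    CondStar (sub (subRen x (renL suc B) ρ) A₁) (sub (subRen x B ρ) A₂) S' ((n₁ + m₁) + 0) (sub (subRen x B₀ ρ) (contract A' A₂'))
  condStar-subRen A₁ A₂ x B ρ S S' n₁ m₁ A' A₂' B₀ hyp awB dA lA dA₂ lA₂ sp₁ aw dB =
    n₁ , m₁ , sub (extS σL) A' , sub σ A₂' ,
    dev-level-≡ (sub (subRen x (renL suc B) ρ) A₁) S' _ (+-identityʳ (suc n₁))
      (dev-subRen A₁ x (renL suc B) ρ S S' (suc n₁) 0 (lam (lab zero) A') (renL suc B₀) (transportsExcept-appˡ x ρ A₁ A₂ S S' hyp)
         (away-renL S' B awB) dA (dev-renL suc B S' 0 B₀ dB) (λ ())) ,
    lams-sub {n₁} (extS σL) A' lA ,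
    dev-level-≡ (sub (subRen x B ρ) A₂) S' _ (+-identityʳ m₁)
      (dev-subRen A₂ x B ρ S S' m₁ 0 A₂' B₀ (transportsExcept-appʳ x ρ A₁ A₂ S S' hyp) awB dA₂ dB (λ ())) ,
    lams-sub {m₁} σ A₂' lA₂ ,
    sym (+-identityʳ (n₁ + m₁)) ,
    (λ p → spine₀-sub-extS {n₁} σL A' (sp₁ p)) ,
    away-redex-sub⁺ x ρ (app A₁ A₂) S S' B σL σ (lam (lab zero) A') A₂' hyp awB
      (dev-within-renL x ρ B S' 0 B₀ dB) (dev-within x ρ B S' 0 B₀ dB)
      (λ z f → fv-redex A₁ A₂ S n₁ m₁ A' A₂' z dA dA₂ f) aw ,
    trans (sub-contract σ A' A₂') (cong (λ Z → contract Z (sub σ A₂')) (sub-ext (extS-ext (renL-subRen x B₀ ρ)) A'))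
    where
    σ : ℕ → Tm
    σ = subRen x B₀ ρ
    σL : ℕ → Tm
    σL = subRen x (renL suc B₀) ρ

  -- The redex body is independent of what replaces x, so B is developed at level 0 there.
  condStar-subRen-arg : ∀ A₁ A₂ x B ρ S S' n₁ m₁ m A' A₂' B₀ → TransportsExcept x ρ (app A₁ A₂) S S' → Away S' B →
    Dev A₁ S (suc n₁) (lam (lab zero) A') → Lams n₁ A' → Dev A₂ S m₁ A₂' → Spine n₁ zero A' → Spine m₁ x A₂' →
    Away S (app (lam (lab zero) A') A₂') → Dev B S' (suc m) B₀ →
    CondStar (sub (subRen x (renL suc B) ρ) A₁) (sub (subRen x B ρ) A₂) S' ((n₁ + m₁) + suc m) (sub (subRen x B₀ ρ) (contract A' A₂'))
  condStar-subRen-arg A₁ A₂ x B ρ S S' n₁ m₁ m A' A₂' B₀ hyp awB dA lA dA₂ s₀ sx aw dB =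
    n₁ , m₁ + suc m , sub (extS σL₀) A' , sub σ A₂' ,
    dev-level-≡ (sub (subRen x (renL suc B) ρ) A₁) S' _ (+-identityʳ (suc n₁))
      (dev-subRen A₁ x (renL suc B) ρ S S' (suc n₁) 0 (lam (lab zero) A') (renL suc B₁) (transportsExcept-appˡ x ρ A₁ A₂ S S' hyp)
         (away-renL S' B awB) dA (dev-renL suc B S' 0 B₁ dB₁) (λ ())) ,
    lams-sub {n₁} (extS σL₀) A' lA ,
    dev-subRen A₂ x B ρ S S' m₁ (suc m) A₂' B₀ (transportsExcept-appʳ x ρ A₁ A₂ S S' hyp) awB dA₂ dB (λ _ → sx) ,
    lams-sub-spine {m₁} {suc m} {x} σ A₂' sx (subst (Lams (suc m)) (sym (subRen-self x B₀ ρ)) (dev-lams B S' (suc m) B₀ dB)) ,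
    sym (+-assoc n₁ m₁ (suc m)) ,
    (λ _ → spine₀-sub-extS {n₁} σL₀ A' s₀) ,
    away-redex-sub⁺ x ρ (app A₁ A₂) S S' B σL₀ σ (lam (lab zero) A') A₂' hyp awB
      (dev-within-renL x ρ B S' 0 B₁ dB₁) (dev-within x ρ B S' (suc m) B₀ dB)
      (λ z f → fv-redex A₁ A₂ S n₁ m₁ A' A₂' z dA dA₂ f) aw ,
    trans (sub-contract σ A' A₂') (cong (λ Z → contract Z (sub σ A₂')) (sub-extS-spine₀ {n₁} _ σL₀ A' s₀))
    where
    B₁ : Tm
    B₁ = proj₁ (dev₀-total B S')
    dB₁ : Dev B S' 0 B₁
    dB₁ = proj₂ (dev₀-total B S')
    σ : ℕ → Tm
    σ = subRen x B₀ ρ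
    σL₀ : ℕ → Tm
    σL₀ = subRen x (renL suc B₁) ρ

  -- Dually, the redex argument is dropped by the contraction, so B is developed at level 0 there.
  condStar-subRen-body : ∀ A₁ A₂ x B ρ S S' n₁ m A' A₂' B₀ → TransportsExcept x ρ (app A₁ A₂) S S' → Away S' B →
    Dev A₁ S (suc n₁) (lam (lab zero) A') → Dev A₂ S 0 A₂' → Spine n₁ (suc x) A' →
    Away S (app (lam (lab zero) A') A₂') → Dev B S' (suc m) B₀ →
    CondStar (sub (subRen x (renL suc B) ρ) A₁) (sub (subRen x B ρ) A₂) S' ((n₁ + 0) + suc m) (sub (subRen x B₀ ρ) (contract A' A₂'))
  condStar-subRen-body A₁ A₂ x B ρ S S' n₁ m A' A₂' B₀ hyp awB dA dA₂ sx aw dB =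
    n₁ + suc m , 0 , sub (extS σL) A' , sub σ₀ A₂' ,
    dev-subRen A₁ x (renL suc B) ρ S S' (suc n₁) (suc m) (lam (lab zero) A') (renL suc B₀) (transportsExcept-appˡ x ρ A₁ A₂ S S' hyp)
      (away-renL S' B awB) dA (dev-renL suc B S' (suc m) B₀ dB) (λ _ → sx) ,
    lams-sub-spine {n₁} {suc m} {suc x} (extS σL) A' sx
      (lams-renV⁺ {suc m} suc (σL x) (subst (Lams (suc m)) (sym (subRen-self x (renL suc B₀) ρ))
        (lams-renL {suc m} suc B₀ (dev-lams B S' (suc m) B₀ dB)))) ,
    dev-subRen A₂ x B ρ S S' 0 0 A₂' B₁ (transportsExcept-appʳ x ρ A₁ A₂ S S' hyp) awB dA₂ dB₁ (λ ()) ,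
    tt ,
    trans (+-identityʳ _) (cong (_+ suc m) (sym (+-identityʳ n₁))) ,
    (λ ()) ,
    away-redex-sub⁺ x ρ (app A₁ A₂) S S' B σL σ₀ (lam (lab zero) A') A₂' hyp awB
      (dev-within-renL x ρ B S' (suc m) B₀ dB) (dev-within x ρ B S' 0 B₁ dB₁)
      (λ z f → fv-redex A₁ A₂ S n₁ 0 A' A₂' z dA dA₂ f) aw ,
    trans (sub-contract σ A' A₂') (trans (cong (λ Z → contract Z (sub σ A₂')) (sub-ext (extS-ext (renL-subRen x B₀ ρ)) A'))
      (contract-irrel _ _ _ (¬fv₀-sub-extS-spine {n₁} {x} σL A' sx)))
    where
    B₁ : Tm
    B₁ = proj₁ (dev₀-total B S')
    dB₁ : Dev B S' 0 B₁
    dB₁ = proj₂ (dev₀-total B S')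
    σ : ℕ → Tm
    σ = subRen x B₀ ρ
    σL : ℕ → Tm
    σL = subRen x (renL suc B₀) ρ
    σ₀ : ℕ → Tm
    σ₀ = subRen x B₁ ρ

  ¬condStar-subRen : ∀ A₁ A₂ x B ρ S S' → TransportsExcept x ρ (app A₁ A₂) S S' → Away S' B → ¬ (Σ Tm (CondStar A₁ A₂ S 0)) →
    ¬ (Σ Tm (CondStar (sub (subRen x (renL suc B) ρ) A₁) (sub (subRen x B ρ) A₂) S' 0))
  ¬condStar-subRen A₁ A₂ x B ρ S S' hyp awB nc (C' , zero , zero , X , Y , dX , _ , dY , _ , refl , _ , aw' , _)
    with dev-subRen⁻ A₂ x B ρ S S' 0 Y (transportsExcept-appʳ x ρ A₁ A₂ S S' hyp) awB dY
  ... | zero , zero , A₂' , B₂ , refl , dA₂' , dB₂ , _ , refl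
    with dev-subRen⁻ A₁ x (renL suc B) ρ S S' 1 (lam (lab zero) X) (transportsExcept-appˡ x ρ A₁ A₂ S S' hyp) (away-renL S' B awB) dX
  ... | p , q , A₁' , B₁ , e₁ , dA₁' , dB₁ , spq , eX with dev-renL⁻ suc B S' q B₁ dB₁
  ... | B₁' , refl , dB₁' = helper p q e₁ A₁' dA₁' dB₁' spq eX
    where
    helper : ∀ p q → 1 ≡ p + q → ∀ A₁' → Dev A₁ S p A₁' → Dev B S' q B₁' → (0 < q → Spine p x A₁') →
      lam (lab zero) X ≡ sub (subRen x (renL suc B₁') ρ) A₁' → ⊥
    helper zero (suc zero) e A₁' d db spq eX with spq (s≤s z≤n)
    ... | refl = renL-suc≢lam₀ B₁' X (sym (trans eX (subRen-self x (renL suc B₁') ρ)))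
    helper (suc zero) zero e A₁' d db spq eX with lams-suc⇒lam {0} A₁' (dev-lams A₁ S 1 A₁' d)
    ... | a , W , refl with eX
    ... | refl = nc (contract W A₂' , 0 , 0 , W , A₂' , d , tt , dA₂' , tt , refl , (λ ()) ,
           away-redex-sub⁻ x ρ (app A₁ A₂) S S' B (subRen x (renL suc B₁') ρ) (subRen x B₂ ρ) (lam (lab zero) W) A₂' hyp
             (dev-within-renL x ρ B S' 0 B₁' db) (dev-within x ρ B S' 0 B₂ dB₂)
             (λ z f → fv-redex A₁ A₂ S 0 0 W A₂' z d dA₂' f) aw' , refl)
    helper zero zero () A₁' d db spq eX
    helper zero (suc (suc q)) () A₁' d db spq eX
    helper (suc zero) (suc q) () A₁' d db spq eX
    helper (suc (suc p)) q () A₁' d db spq eX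
  ¬condStar-subRen A₁ A₂ x B ρ S S' hyp awB nc (C' , zero , suc m , X , Y , dX , _ , dY , _ , () , _)
  ¬condStar-subRen A₁ A₂ x B ρ S S' hyp awB nc (C' , suc n , m , X , Y , dX , _ , dY , _ , () , _)

  dev-subRen⁻ : ∀ T x B ρ S S' k C → TransportsExcept x ρ T S S' → Away S' B → Dev (sub (subRen x B ρ) T) S' k C → SubstSplit x B ρ T S S' k C
  dev-subRen⁻ (var y) x B ρ S S' k C hyp awB d with y ≟ x
  ... | yes refl = 0 , k , var x , C , refl , refl , subst (λ P → Dev P S' k C) (subRen-self x B ρ) d , (λ _ → refl) , sym (subRen-self x C ρ)
  ... | no ne = dev-subRen⁻-other x B ρ S S' y k C ne (subst (λ P → Dev P S' k C) (subRen-other x B ρ y ne) d)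
  dev-subRen⁻ (lam a T) x B ρ S S' zero C hyp awB (X , d , refl)
    with dev-subRen⁻ T (suc x) (renV suc B) (extR ρ) (bind S) (bind S') 0 X (transportsExcept-bind x ρ a T S S' hyp) (away-bind-renV S' B awB)
           (subst (λ P → Dev P (bind S') 0 X) (sub-extS-subRen x B ρ T) d)
  ... | zero , zero , A₁ , B₁' , refl , dA₁ , dB₁' , sp , eX with dev-renV⁻ suc B S' (bind S') 0 B₁' (transports-suc-bind B S') dB₁'
  ... | B₁ , refl , dB₁ = 0 , 0 , lam a A₁ , B₁ , refl , (A₁ , dA₁ , refl) , dB₁ , (λ ()) , cong (lam a) (trans eX (sym (sub-extS-subRen x B₁ ρ A₁)))
  dev-subRen⁻ (lam a T) x B ρ S S' (suc k) C hyp awB (X , d , refl)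
    with dev-subRen⁻ T (suc x) (renV suc B) (extR ρ) (under S) (under S') k X (transportsExcept-under x ρ a T S S' hyp) (away-under-renV S' B awB)
           (subst (λ P → Dev P (under S') k X) (sub-extS-subRen x B ρ T) d)
  ... | n₁ , m₁ , A₁ , B₁' , e , dA₁ , dB₁' , sp , eX with dev-renV⁻ suc B S' (under S') m₁ B₁' (transports-suc-under B S') dB₁'
  ... | B₁ , refl , dB₁ = suc n₁ , m₁ , lam a A₁ , B₁ , cong suc e , (A₁ , dA₁ , refl) , dB₁ , sp , cong (lam a) (trans eX (sym (sub-extS-subRen x B₁ ρ A₁)))
  dev-subRen⁻ (app A₁ A₂) x B ρ S S' k C hyp awB d =
    dev-subRen⁻-app A₁ A₂ x B ρ S S' k C hyp awB (subst (λ P → Dev (app P (sub (subRen x B ρ) A₂)) S' k C) (sub-renL-subRen x B ρ A₁) d)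

  dev-subRen⁻-app : ∀ A₁ A₂ x B ρ S S' k C → TransportsExcept x ρ (app A₁ A₂) S S' → Away S' B →
    Dev (app (sub (subRen x (renL suc B) ρ) A₁) (sub (subRen x B ρ) A₂)) S' k C → SubstSplit x B ρ (app A₁ A₂) S S' k C
  dev-subRen⁻-app A₁ A₂ x B ρ S S' k C hyp awB (inj₂ (refl , nc , X , Y , dX , dY , refl))
    with dev-subRen⁻ A₁ x (renL suc B) ρ S S' 0 X (transportsExcept-appˡ x ρ A₁ A₂ S S' hyp) (away-renL S' B awB) dX
  ... | zero , zero , A₁₀ , B₁ , refl , dA₁₀ , dB₁ , _ , eX
    with dev-subRen⁻ A₂ x B ρ S S' 0 Y (transportsExcept-appʳ x ρ A₁ A₂ S S' hyp) awB dY
  ... | zero , zero , A₂₀ , B₂ , refl , dA₂₀ , dB₂ , _ , eY with dev-renL⁻ suc B S' 0 B₁ dB₁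
  ... | B₁' , refl , dB₁' with dev-functional B S' 0 B₁' B₂ dB₁' dB₂
  ... | refl = 0 , 0 , app A₁₀ A₂₀ , B₁' , refl ,
         inj₂ (refl , ¬condStar-subRen⁻ A₁ A₂ x B ρ S S' B₁' hyp awB dB₁' nc , A₁₀ , A₂₀ , dA₁₀ , dA₂₀ , refl) ,
         dB₁' , (λ ()) , cong₂ app (trans eX (sym (sub-renL-subRen x B₁' ρ A₁₀))) eY
  dev-subRen⁻-app A₁ A₂ x B ρ S S' k C hyp awB (inj₁ (n' , m' , X , Y , dX , lX , dY , lY , e' , sp' , aw' , refl))
    with dev-subRen⁻ A₁ x (renL suc B) ρ S S' (suc n') (lam (lab zero) X) (transportsExcept-appˡ x ρ A₁ A₂ S S' hyp) (away-renL S' B awB) dX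
  ... | p , q , A₁₀ , B₁ , e₁ , dA₁₀ , dB₁ , spq , eX with dev-renL⁻ suc B S' q B₁ dB₁
  ... | B₁' , refl , dB₁' with dev-subRen⁻ A₂ x B ρ S S' m' Y (transportsExcept-appʳ x ρ A₁ A₂ S S' hyp) awB dY
  ... | r , s , A₂₀ , B₂ , e₂ , dA₂₀ , dB₂ , sps , eY =
    dev-subRen⁻-redex A₁ A₂ x B ρ S S' k n' m' X Y p q A₁₀ B₁' r s A₂₀ B₂ hyp sp' aw' e'
      e₁ dA₁₀ dB₁' spq eX e₂ dA₂₀ dB₂ sps eY

  ¬condStar-subRen⁻ : ∀ A₁ A₂ x B ρ S S' B₂ → TransportsExcept x ρ (app A₁ A₂) S S' → Away S' B → Dev B S' 0 B₂ →
    ¬ (Σ Tm (CondStar (sub (subRen x (renL suc B) ρ) A₁) (sub (subRen x B ρ) A₂) S' 0)) → ¬ (Σ Tm (CondStar A₁ A₂ S 0))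
  ¬condStar-subRen⁻ A₁ A₂ x B ρ S S' B₂ hyp awB dB₂ nc (C' , zero , zero , W , V , dW , _ , dV , _ , refl , _ , awWV , _) =
    nc (_ , 0 , 0 , sub (extS (subRen x (renL suc B₂) ρ)) W , sub (subRen x B₂ ρ) V ,
      dev-subRen A₁ x (renL suc B) ρ S S' 1 0 (lam (lab zero) W) (renL suc B₂) (transportsExcept-appˡ x ρ A₁ A₂ S S' hyp) (away-renL S' B awB)
        dW (dev-renL suc B S' 0 B₂ dB₂) (λ ()) ,
      tt ,
      dev-subRen A₂ x B ρ S S' 0 0 V B₂ (transportsExcept-appʳ x ρ A₁ A₂ S S' hyp) awB dV dB₂ (λ ()) ,
      tt , refl , (λ ()) ,
      away-redex-sub⁺ x ρ (app A₁ A₂) S S' B (subRen x (renL suc B₂) ρ) (subRen x B₂ ρ) (lam (lab zero) W) V hyp awB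
        (dev-within-renL x ρ B S' 0 B₂ dB₂) (dev-within x ρ B S' 0 B₂ dB₂)
        (λ z f → fv-redex A₁ A₂ S 0 0 W V z dW dV f) awWV ,
      refl)
  ¬condStar-subRen⁻ A₁ A₂ x B ρ S S' B₂ hyp awB dB₂ nc (C' , zero , suc m , W , V , dW , _ , dV , _ , () , _)
  ¬condStar-subRen⁻ A₁ A₂ x B ρ S S' B₂ hyp awB dB₂ nc (C' , suc n , m , W , V , dW , _ , dV , _ , () , _)


-- Superdevelopment of a contractum
transportsExcept-contract : ∀ X S → TransportsExcept 0 pred (subL star₀ X) (under S) S
transportsExcept-contract X S = (λ _ m → zero∉under S m) ,
  λ { zero ne f → ⊥-elim (ne refl) ; (suc y) ne f → suc∈under⁻ S , suc∈under S }

dev-contract⁻ : ∀ X Y S k C → Away S Y → Dev (contract X Y) S k C →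
  Σ ℕ λ n → Σ ℕ λ m → Σ Tm λ X₀ → Σ Tm λ Y₀ →
    k ≡ n + m × Dev X (under S) n X₀ × Dev Y S m Y₀ × (0 < m → Spine n zero X₀) × C ≡ contract X₀ Y₀
dev-contract⁻ X Y S k C awY d
  with dev-subRen⁻ (subL star₀ X) 0 Y pred (under S) S k C (transportsExcept-contract X S) awY (subst (λ P → Dev P S k C) (contract-as-sub X Y) d)
... | n , m , A₀ , Y₀ , e , dA , dY , sp , eC with dev-subL⁻ star₀ X (under S) n A₀ dA
... | X₀ , refl , dX₀ = n , m , X₀ , Y₀ , e , dX₀ , dY , (λ p → spine-subL⁻ {n} {zero} star₀ X₀ (sp p)) ,
        trans eC (sym (contract-as-sub X₀ Y₀))

dev-contract : ∀ X Y S n m X₀ Y₀ → Away S Y → Dev X (under S) n X₀ → Dev Y S m Y₀ → (0 < m → Spine n zero X₀) →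
  Dev (contract X Y) S (n + m) (contract X₀ Y₀)
dev-contract X Y S n m X₀ Y₀ awY dX dY sp =
  subst₂ (λ P Q → Dev P S (n + m) Q) (sym (contract-as-sub X Y)) (sym (contract-as-sub X₀ Y₀))
    (dev-subRen (subL star₀ X) 0 Y pred (under S) S n m (subL star₀ X₀) Y₀ (transportsExcept-contract X S) awY
      (dev-subL star₀ X (under S) n X₀ dX) dY (λ p → spine-subL⁺ {n} {zero} star₀ X₀ (sp p)))


-- Supersteps preserve the superdevelopment
step-lams : ∀ {S k A B} → Step S k A B → Lams k B
step-lams st-var = tt
step-lams (st-lam0 st) = tt
step-lams (st-lamS st) = step-lams st
step-lams (st-app st st₁) = tt
step-lams (st-beta {n = n} {zero} {A' = A'} {B' = B'} stA stB aw sp) =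
  subst (λ j → Lams j (contract A' B')) (sym (+-identityʳ n)) (lams-contract {n} A' B' (step-lams stA))
step-lams (st-beta {n = n} {suc m} {A' = A'} {B' = B'} stA stB aw sp) =
  lams-contract-spine {n} {suc m} A' B' (sp (s≤s z≤n)) (step-lams stB)

under⊆ : ∀ S₂ S₁ → S₂ ⊆ S₁ → under S₂ ⊆ under S₁
under⊆ S₂ S₁ S₂⊆S₁ m with ∈-map⁻ suc m
... | z , m' , refl = suc∈under S₁ (S₂⊆S₁ m')

bind⊆ : ∀ S₂ S₁ → S₂ ⊆ S₁ → bind S₂ ⊆ bind S₁
bind⊆ S₂ S₁ S₂⊆S₁ (here e) = here e
bind⊆ S₂ S₁ S₂⊆S₁ (there m) = there (under⊆ S₂ S₁ S₂⊆S₁ m)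

under⊆bind : ∀ S₂ S₁ → S₂ ⊆ S₁ → under S₂ ⊆ bind S₁
under⊆bind S₂ S₁ S₂⊆S₁ m = there (under⊆ S₂ S₁ S₂⊆S₁ m)

away⊆ : ∀ S₂ S₁ R → S₂ ⊆ S₁ → Away S₁ R → Away S₂ R
away⊆ S₂ S₁ R S₂⊆S₁ aw y f m = aw y f (S₂⊆S₁ m)

SameDev : Tm → Tm → Seq → ℕ → Set
SameDev A B S k = ∀ C → Dev A S k C ⇔ Dev B S k C

sameDev-defined : ∀ A B S k → SameDev A B S k →
  (Defined A S k ⇔ Defined B S k) × (∀ C D → Dev A S k C → Dev B S k D → C ≡ D)
sameDev-defined A B S k same =
  mk⇔ (λ { (C , d) → C , Equivalence.to (same C) d }) (λ { (C , d) → C , Equivalence.from (same C) d }) ,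
  λ C D dC dD → dev-functional B S k C D (Equivalence.to (same C) dC) dD

condStar-map : ∀ A B A' B' S k C → (∀ j C → Dev A S j C → Dev A' S j C) → (∀ j C → Dev B S j C → Dev B' S j C) →
  CondStar A B S k C → CondStar A' B' S k C
condStar-map A B A' B' S k C fA fB (n , m , X , Y , dX , lX , dY , lY , e , sp , aw , eC) =
  n , m , X , Y , fA (suc n) _ dX , lX , fB m Y dY , lY , e , sp , aw , eC

dev-app-map : ∀ A B A' B' S k → (∀ j → SameDev A A' S j) → (∀ j → SameDev B B' S j) →
  ∀ C → Dev (app A B) S k C → Dev (app A' B') S k C
dev-app-map A B A' B' S k fA fB C (inj₁ c) =
  inj₁ (condStar-map A B A' B' S k C (λ j C → Equivalence.to (fA j C)) (λ j C → Equivalence.to (fB j C)) c)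
dev-app-map A B A' B' S k fA fB C (inj₂ (e , nc , A₀ , B₀ , dA , dB , eC)) =
  inj₂ (e , (λ { (C' , c) → nc (C' , condStar-map A' B' A B S k C' (λ j C → Equivalence.from (fA j C)) (λ j C → Equivalence.from (fB j C)) c) }) ,
        A₀ , B₀ , Equivalence.to (fA 0 A₀) dA , Equivalence.to (fB 0 B₀) dB , eC)

sameDev-app : ∀ A B A' B' S k → (∀ j → SameDev A A' S j) → (∀ j → SameDev B B' S j) → SameDev (app A B) (app A' B') S k
sameDev-app A B A' B' S k fA fB C =
  mk⇔ (dev-app-map A B A' B' S k fA fB C)
      (dev-app-map A' B' A B S k (λ j C → ⇔.sym (fA j C)) (λ j C → ⇔.sym (fB j C)) C)

away-redex-dev : ∀ S A' B' j j' X Y → Away S (app (lam (lab zero) A') B') → Dev (lam (lab zero) A') S j (lam (lab zero) X) →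
  Dev B' S j' Y → Away S (app (lam (lab zero) X) Y)
away-redex-dev S A' B' j j' X Y aw dX dY y (fappˡ f) = aw y (fappˡ (dev-fv (lam (lab zero) A') S j _ dX f))
away-redex-dev S A' B' j j' X Y aw dX dY y (fappʳ f) = aw y (fappʳ (dev-fv B' S j' Y dY f))

Σ-cong-⇔ˡ : ∀ {P Q R : Tm → Set} → (∀ A₀ → P A₀ ⇔ Q A₀) → (Σ Tm λ A₀ → P A₀ × R A₀) ⇔ (Σ Tm λ A₀ → Q A₀ × R A₀)
Σ-cong-⇔ˡ f = mk⇔ (λ { (A₀ , p , r) → A₀ , Equivalence.to (f A₀) p , r }) (λ { (A₀ , q , r) → A₀ , Equivalence.from (f A₀) q , r })

mutual
  step-sameDev : ∀ {S₁ k₁ A B} → Step S₁ k₁ A B → ∀ S₂ k₂ → S₂ ⊆ S₁ → k₁ ≤ k₂ → SameDev A B S₂ k₂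
  step-sameDev st-var S₂ k₂ S₂⊆S₁ le C = ⇔.refl
  step-sameDev {S₁} (st-lam0 st) S₂ zero S₂⊆S₁ le C =
    Σ-cong-⇔ˡ (step-sameDev st (bind S₂) 0 (bind⊆ S₂ S₁ S₂⊆S₁) z≤n)
  step-sameDev {S₁} (st-lam0 st) S₂ (suc k₂) S₂⊆S₁ le C =
    Σ-cong-⇔ˡ (step-sameDev st (under S₂) k₂ (under⊆bind S₂ S₁ S₂⊆S₁) z≤n)
  step-sameDev {S₁} (st-lamS st) S₂ (suc k₂) S₂⊆S₁ (s≤s le) C =
    Σ-cong-⇔ˡ (step-sameDev st (under S₂) k₂ (under⊆ S₂ S₁ S₂⊆S₁) le)
  step-sameDev (st-app {A = A} {A'} {B} {B'} stA stB) S₂ k₂ S₂⊆S₁ le =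
    sameDev-app A B A' B' S₂ k₂ (λ j → step-sameDev stA S₂ j S₂⊆S₁ z≤n) (λ j → step-sameDev stB S₂ j S₂⊆S₁ z≤n)
  step-sameDev (st-beta stA stB aw sp) S₂ k₂ S₂⊆S₁ le C =
    mk⇔ (redex-dev⇒contract-dev stA stB aw sp S₂ k₂ S₂⊆S₁ le C) (contract-dev⇒redex-dev stA stB aw sp S₂ k₂ S₂⊆S₁ le C)

  redex-dev⇒contract-dev : ∀ {S₁ n m A A' B B'} → Step S₁ (suc n) A (lam (lab zero) A') → Step S₁ m B B' →
    Away S₁ (app (lam (lab zero) A') B') → (0 < m → Spine n zero A') →
    ∀ S₂ k₂ → S₂ ⊆ S₁ → n + m ≤ k₂ → ∀ C → Dev (app A B) S₂ k₂ C → Dev (contract A' B') S₂ k₂ C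
  redex-dev⇒contract-dev {S₁} {n} {m} {A} {A'} {B} {B'} stA stB aw sp S₂ k₂ S₂⊆S₁ le C
    (inj₁ (n₂ , m₂ , X , Y , dX , lX , dY , lY , refl , sp₂ , awXY , refl)) with n ≤? n₂
  ... | no n≰n₂ = ⊥-elim (step-¬varSpine stA S₂ (suc n₂) (lam (lab zero) X) S₂⊆S₁ (s≤s (≰⇒> n≰n₂)) dX
                    (spine⇒varSpine {n₂} {zero} X (sp₂ (m<n∧n+o≤m+p⇒0<p m m₂ (≰⇒> n≰n₂) le))))
  ... | yes n≤n₂ with Equivalence.to (step-sameDev stA S₂ (suc n₂) S₂⊆S₁ (s≤s n≤n₂) _) dX
  ... | X' , dA'X , refl = dev-contract A' B' S₂ n₂ m₂ X' Y (λ y f → aw y (fappʳ f) ∘ S₂⊆S₁) dA'X dB'Y sp₂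
    where
    dB'Y : Dev B' S₂ m₂ Y
    dB'Y = Equivalence.to (step-sameDev stB S₂ m₂ S₂⊆S₁ (dev-spine-split-≤ A' (under S₂) X' sp dA'X n≤n₂ le) Y) dY
  redex-dev⇒contract-dev {S₁} {n} {m} {A} {A'} {B} {B'} stA stB aw sp S₂ k₂ S₂⊆S₁ le C
    (inj₂ (refl , nc , A₀ , B₀ , dA , dB , refl)) =
    ⊥-elim (nc (_ , 0 , 0 , X , B₀ , dA₀ , tt , dB , tt , refl , (λ ()) ,
      away-redex-dev S₂ A' B' 1 0 X B₀ (away⊆ S₂ S₁ _ S₂⊆S₁ aw) (X , dX , refl)
        (Equivalence.to (step-sameDev stB S₂ 0 S₂⊆S₁ (m+n≤o⇒n≤o n le) B₀) dB) , refl))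
    where
    X : Tm
    X = proj₁ (dev₀-total A' (under S₂))
    dX : Dev A' (under S₂) 0 X
    dX = proj₂ (dev₀-total A' (under S₂))
    dA₀ : Dev A S₂ 1 (lam (lab zero) X)
    dA₀ = Equivalence.from (step-sameDev stA S₂ 1 S₂⊆S₁ (s≤s (m+n≤o⇒m≤o n le)) (lam (lab zero) X)) (X , dX , refl)

  contract-dev⇒redex-dev : ∀ {S₁ n m A A' B B'} → Step S₁ (suc n) A (lam (lab zero) A') → Step S₁ m B B' →
    Away S₁ (app (lam (lab zero) A') B') → (0 < m → Spine n zero A') →
    ∀ S₂ k₂ → S₂ ⊆ S₁ → n + m ≤ k₂ → ∀ C → Dev (contract A' B') S₂ k₂ C → Dev (app A B) S₂ k₂ C
  contract-dev⇒redex-dev {S₁} {n} {m} {A} {A'} {B} {B'} stA stB aw sp S₂ k₂ S₂⊆S₁ le C d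
    with dev-contract⁻ A' B' S₂ k₂ C (λ y f → aw y (fappʳ f) ∘ S₂⊆S₁) d
  ... | n₂ , m₂ , X , Y , refl , dX , dY , sp₂ , refl with n ≤? n₂
  ... | no n≰n₂ = ⊥-elim (<⇒≱ (≰⇒> n≰n₂) (spine-lams-le {n₂} {zero} {n} X (sp₂ (m<n∧n+o≤m+p⇒0<p m m₂ (≰⇒> n≰n₂) le))
                    (dev-preserves-lams n A' (under S₂) n₂ X (step-lams stA) dX (<⇒≤ (≰⇒> n≰n₂)))))
  ... | yes n≤n₂ =
    inj₁ (n₂ , m₂ , X , Y , dAX , dev-lams A' (under S₂) n₂ X dX , dBY ,
          dev-lams B' S₂ m₂ Y dY , refl , sp₂ ,
          away-redex-dev S₂ A' B' (suc n₂) m₂ X Y (away⊆ S₂ S₁ _ S₂⊆S₁ aw) (X , dX , refl) dY , refl)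
    where
    dAX : Dev A S₂ (suc n₂) (lam (lab zero) X)
    dAX = Equivalence.from (step-sameDev stA S₂ (suc n₂) S₂⊆S₁ (s≤s n≤n₂) (lam (lab zero) X)) (X , dX , refl)
    dBY : Dev B S₂ m₂ Y
    dBY = Equivalence.from (step-sameDev stB S₂ m₂ S₂⊆S₁ (dev-spine-split-≤ A' (under S₂) X sp dX n≤n₂ le) Y) dY

  step-¬varSpine : ∀ {S₁ j A B} → Step S₁ j A B → ∀ S₂ i C → S₂ ⊆ S₁ → i < j → Dev A S₂ i C → VarSpine i C → ⊥
  step-¬varSpine (st-lamS st) S₂ zero C S₂⊆S₁ lt (A₀ , d , refl) ()
  step-¬varSpine {S₁} (st-lamS st) S₂ (suc i) C S₂⊆S₁ (s≤s lt) (A₀ , d , refl) s =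
    step-¬varSpine st (under S₂) i A₀ (under⊆ S₂ S₁ S₂⊆S₁) lt d s
  step-¬varSpine (st-beta stA stB aw sp) S₂ i C S₂⊆S₁ lt (inj₂ (refl , _ , A₀ , B₀ , _ , _ , refl)) ()
  step-¬varSpine (st-beta {n = n} {m} {A} {A'} stA stB aw sp) S₂ i C S₂⊆S₁ lt
    (inj₁ (n₂ , m₂ , X , Y , dX , lX , dY , lY , refl , sp₂ , awXY , refl)) s
    with varSpine-contract⁻ {n₂} {m₂} X Y lX sp₂ s
  ... | sX , f with n₂ <? n
  ... | yes n₂<n = step-¬varSpine stA S₂ (suc n₂) (lam (lab zero) X) S₂⊆S₁ (s≤s n₂<n) dX sX
  ... | no n₂≮n with +-cancelˡ-< n m₂ m (≤-<-trans (+-monoˡ-≤ m₂ (≮⇒≥ n₂≮n)) lt)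
                   | Equivalence.to (step-sameDev stA S₂ (suc n₂) S₂⊆S₁ (s≤s (≮⇒≥ n₂≮n)) _) dX
  ... | m₂<m | X' , dA'X , refl with dev-spine⁻ n zero A' (under S₂) n₂ X' (sp (≤-<-trans z≤n m₂<m)) dA'X
  ... | n₂≤n , refl = step-¬varSpine stB S₂ m₂ Y S₂⊆S₁ m₂<m dY
    (f (subst (λ j → Spine j zero X') (sym (≤-antisym n₂≤n (≮⇒≥ n₂≮n))) (sp (≤-<-trans z≤n m₂<m))))

steps-sameDev : ∀ S k A₁ Aₙ → Star (Step S k) A₁ Aₙ → SameDev A₁ Aₙ S k
steps-sameDev S k A₁ .A₁ ε C = ⇔.refl
steps-sameDev S k A₁ Aₙ (st ◅ sts) C = ⇔.trans (step-sameDev st S k id ≤-refl C) (steps-sameDev S k _ Aₙ sts C)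

substitution-lemma : ∀ (A B : Tm) (S : Seq) (x k : ℕ) →
  ¬ (x ∈ S × FreeIn x A) → ¬ FreeIn x B → Away S B →
  (Defined (A [ x := B ]) S k
     ⇔ (Σ ℕ λ n → Σ ℕ λ m → Σ Tm λ A₀ → Σ Tm λ B₀ →
          k ≡ n + m × Dev A S n A₀ × Dev B S m B₀ × (0 < m → Spine n x A₀)))
  × (∀ (n m : ℕ) (A₀ B₀ : Tm) → k ≡ n + m → Dev A S n A₀ → Dev B S m B₀ →
       (0 < m → Spine n x A₀) →
       ∀ (C : Tm) → Dev (A [ x := B ]) S k C → C ≡ A₀ [ x := B₀ ])
substitution-lemma A B S x k x∉S∩A _ awB = mk⇔ split unsplit , unique
  where
  hyp : TransportsExcept x id A S S
  hyp = (λ f m → x∉S∩A (m , f)) , (λ y ne f → id , id)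
  split : Defined (A [ x := B ]) S k → Σ ℕ λ n → Σ ℕ λ m → Σ Tm λ A₀ → Σ Tm λ B₀ →
          k ≡ n + m × Dev A S n A₀ × Dev B S m B₀ × (0 < m → Spine n x A₀)
  split (C , d) with dev-subRen⁻ A x B id S S k C hyp awB d
  ... | n , m , A₀ , B₀ , e , dA , dB , sp , _ = n , m , A₀ , B₀ , e , dA , dB , sp
  unsplit : (Σ ℕ λ n → Σ ℕ λ m → Σ Tm λ A₀ → Σ Tm λ B₀ →
            k ≡ n + m × Dev A S n A₀ × Dev B S m B₀ × (0 < m → Spine n x A₀)) → Defined (A [ x := B ]) S k
  unsplit (n , m , A₀ , B₀ , refl , dA , dB , sp) = _ , dev-subRen A x B id S S n m A₀ B₀ hyp awB dA dB sp
  unique : ∀ n m A₀ B₀ → k ≡ n + m → Dev A S n A₀ → Dev B S m B₀ → (0 < m → Spine n x A₀) →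
           ∀ C → Dev (A [ x := B ]) S k C → C ≡ A₀ [ x := B₀ ]
  unique n m A₀ B₀ refl dA dB sp C d =
    dev-functional (A [ x := B ]) S (n + m) C _ d (dev-subRen A x B id S S n m A₀ B₀ hyp awB dA dB sp)

mainTheorem13 :
    (∀ (A B : Tm) (S : Seq) (x k : ℕ) →
       ¬ (x ∈ S × FreeIn x A) → ¬ FreeIn x B → Away S B →
       (Defined (A [ x := B ]) S k
          ⇔ (Σ ℕ λ n → Σ ℕ λ m → Σ Tm λ A₀ → Σ Tm λ B₀ →
               k ≡ n + m × Dev A S n A₀ × Dev B S m B₀ × (0 < m → Spine n x A₀)))
       × (∀ (n m : ℕ) (A₀ B₀ : Tm) → k ≡ n + m → Dev A S n A₀ → Dev B S m B₀ →
            (0 < m → Spine n x A₀) →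
            ∀ (C : Tm) → Dev (A [ x := B ]) S k C → C ≡ A₀ [ x := B₀ ]))
    ×
    (∀ (A B : Tm) (S₁ S₂ : Seq) (k₁ k₂ : ℕ) →
       S₂ ⊆ S₁ → k₁ ≤ k₂ → Step S₁ k₁ A B →
       (Defined A S₂ k₂ ⇔ Defined B S₂ k₂)
       × (∀ (C D : Tm) → Dev A S₂ k₂ C → Dev B S₂ k₂ D → C ≡ D))
    ×
    (∀ (S : Seq) (k : ℕ) (A₁ Aₙ : Tm) →
       Star (Step S k) A₁ Aₙ →
       (Defined A₁ S k ⇔ Defined Aₙ S k)
       × (∀ (C D : Tm) → Dev A₁ S k C → Dev Aₙ S k D → C ≡ D))
mainTheorem13 =
  substitution-lemma ,
  (λ A B S₁ S₂ k₁ k₂ S₂⊆S₁ k₁≤k₂ st → sameDev-defined A B S₂ k₂ (step-sameDev st S₂ k₂ S₂⊆S₁ k₁≤k₂)) ,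
  (λ S k A₁ Aₙ sts → sameDev-defined A₁ Aₙ S k (steps-sameDev S k A₁ Aₙ sts))
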